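{- Let $s\geq 2$ be an integer. (a) If $m\geq 5$ is an odd integer, then $\mbox{min-seed}(C_m\oslash C_{3s},3)=ms+1$. (b) If $m\geq 8$ is an even integer and $s$ is even, then $\mbox{min-seed}(C_m\oslash C_{3s},3)=ms+1$. (c) If $m\geq 8$ is an even integer and $s$ is odd, then $\mbox{min-seed}(C_m\oslash C_{3s},3)\in\{ms+1,\,ms+2\}$.
   Context: The $m\times n$ torus cordalis $C_m\oslash C_n$ has vertex set $\{(i,j):1\leq i\leq m,\ 1\leq j\leq n\}$; its edges are those of the toroidal mesh $C_m\Box C_n$ (where $(i,j)$ is adjacent to $(i\pm1,j)$ and $(i,j\pm1)$, first coordinate modulo $m$, second modulo $n$), except that for each $1\leq i\leq m$ the edge $(i,n)(i,1)$ is replaced by the edge $(i,n)(i+1,1)$ (first coordinate modulo $m$). For a graph $G$ and positive integer $k$, the activation process in $(G,k)$ starting at $S\subseteq V(G)$: at time $0$ exactly the vertices of $S$ are active; at each subsequent step every inactive vertex with at least $k$ active neighbors becomes active; active vertices stay active; the process stops when nothing changes. $\mbox{min-seed}(G,k)$ is the minimum size of a set $S\subseteq V(G)$ such that at the end of this process all vertices of $G$ are active. -}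

module Defs where

open import Data.Nat using (ℕ; zero; suc; _+_; _*_; _∸_; _≡ᵇ_; _<ᵇ_; _≤ᵇ_)
open import Data.Fin as F using (Fin; toℕ)
open import Data.Bool using (Bool; true; false; _∧_; _∨_; if_then_else_)
open import Data.Product using (_×_; _,_; ∃)
open import Relation.Binary.PropositionalEquality using (_≡_)

sumFin : ∀ {n} → (Fin n → ℕ) → ℕ
sumFin {zero}  f = 0
sumFin {suc n} f = f F.zero + sumFin (λ i → f (F.suc i))

count : ∀ {n} → (Fin n → Bool) → ℕ
count p = sumFin (λ i → if p i then 1 else 0)

-- The torus cordalis C_m ⊘ C_n.
-- Vertex (i , j) : Fin m × Fin n stands for the paper's (i+1 , j+1).

Vertex : ℕ → ℕ → Set
Vertex m n = Fin m × Fin n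

VSet : ℕ → ℕ → Set
VSet m n = Vertex m n → Bool

size : ∀ {m n} → VSet m n → ℕ
size S = sumFin (λ i → count (λ j → S (i , j)))

sucMod : ℕ → ℕ → ℕ
sucMod m a = if suc a ≡ᵇ m then 0 else suc a

-- directed "generating" edges of C_m ⊘ C_n from (i , j) to (i' , j'):
--  * vertical   (i , j) — (i+1 mod m , j)
--  * horizontal (i , j) — (i , j+1)          for j+1 < n
--  * twisted    (i , n) — (i+1 mod m , 1)    (1-based; replaces (i,n)(i,1))
edgeC : (m n : ℕ) → ℕ → ℕ → ℕ → ℕ → Bool
edgeC m n i j i' j' =
     ((i' ≡ᵇ sucMod m i) ∧ (j' ≡ᵇ j))
  ∨ ((i' ≡ᵇ i) ∧ (suc j <ᵇ n) ∧ (j' ≡ᵇ suc j))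
  ∨ ((suc j ≡ᵇ n) ∧ (j' ≡ᵇ 0) ∧ (i' ≡ᵇ sucMod m i))

adj : ∀ {m n} → Vertex m n → Vertex m n → Bool
adj {m} {n} (i , j) (i' , j') =
     edgeC m n (toℕ i) (toℕ j) (toℕ i') (toℕ j')
  ∨ edgeC m n (toℕ i') (toℕ j') (toℕ i) (toℕ j)

activeNbrs : ∀ {m n} → VSet m n → Vertex m n → ℕ
activeNbrs A v = sumFin (λ i' → count (λ j' → adj v (i' , j') ∧ A (i' , j')))

step : ∀ {m n} → ℕ → VSet m n → VSet m n
step k A v = A v ∨ (k ≤ᵇ activeNbrs A v)

activeAt : ∀ {m n} → ℕ → VSet m n → ℕ → VSet m n
activeAt k S zero    = S
activeAt k S (suc t) = step k (activeAt k S t)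

Percolates : ∀ {m n} → ℕ → VSet m n → Set
Percolates {m} {n} k S = ∃ λ t → ∀ (v : Vertex m n) → activeAt k S t v ≡ true

IsMinSeed : ℕ → ℕ → ℕ → ℕ → Set
IsMinSeed m n k c =
  (∃ λ (S : VSet m n) → Percolates k S × size S ≡ c)
  × (∀ (S : VSet m n) → Percolates k S → c Data.Nat.≤ size S)
  where import Data.Nat

Even : ℕ → Set
Even n = ∃ λ k → n ≡ 2 * k

Odd : ℕ → Set
Odd n = ∃ λ k → n ≡ 2 * k + 1

module Submission where

-- Lower bound (all m, s ≥ 1).  Let links(A) count the ordered adjacent pairs
-- inside A.  A vertex activated in a step has at least 3 active neighbours,
-- so 6|A| − links(A) never increases along the process.  In the last step
-- the newly active set D satisfies links(A) + 3|D| ≤ 4|A| (degrees are ≤ 4)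
-- and |A| + |D| = 3ms; together this forces |S| ≥ ms+1 for every
-- percolating seed S.
--
-- Upper bound (all s ≥ 1).  Explicit seeds: row i contains the columns
-- j ≡ p(i) (mod 3) for a row pattern p, plus the vertex (0,1) and, for m even
-- and s odd, one more vertex.  An activation calculus ("a vertex with three
-- distinct eventually active neighbours is eventually active") turns a
-- propagation schedule into a percolation proof; the schedule is written
-- once for a generic pattern and instantiated for m odd and m even.
-- Counting rows gives the sizes ms+1 and ms+2.
--
-- Part (c) asks for the exact minimum: whether a seed of size ms+1
-- percolates is decidable by exhaustive search, because the process is
-- stable after m·n steps; either way min-seed ∈ {ms+1, ms+2}.

open import Defs
open import Data.Nat
open import Data.Nat.Properties
open import Data.Nat.Tactic.RingSolver using (solve-∀)
open import Data.Fin as F using (Fin; toℕ; fromℕ<; combine; remQuot)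
open import Data.Fin.Properties
  using (toℕ-injective; toℕ-fromℕ<; toℕ<n; all?; any?; ¬∀⟶∃¬; remQuot-combine)
  renaming (_≟_ to _≟F_; suc-injective to Fsuc-injective)
open import Data.Bool using (Bool; true; false; _∧_; _∨_; not; if_then_else_; T)
open import Data.Bool.Properties using (∨-comm; ∧-zeroʳ; T-≡) renaming (_≟_ to _≟B_)
open import Data.Fin.Subset using (Subset)
open import Data.Fin.Subset.Properties using (anySubset?)
open import Data.Vec using (lookup; tabulate)
open import Data.Vec.Properties using (lookup∘tabulate)
open import Data.Product using (_×_; _,_; ∃; proj₁; proj₂)
open import Data.Product.Properties using (≡-dec)
open import Data.Sum using (_⊎_; inj₁; inj₂)
open import Data.Empty using (⊥; ⊥-elim)
open import Function.Bundles using (Equivalence)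
open import Relation.Binary.PropositionalEquality
open import Relation.Nullary using (¬_; Dec; yes; no; does)
open import Relation.Nullary.Decidable using (_×-dec_)
open import Algebra.Properties.Semiring.Sum +-*-semiring
  using (sum; sum-cong-≗; ∑-distrib-+; ∑-comm; *-distribˡ-sum)

⟦_⟧ : Bool → ℕ
⟦ b ⟧ = if b then 1 else 0

⟦⟧≤1 : ∀ b → ⟦ b ⟧ ≤ 1
⟦⟧≤1 false = z≤n
⟦⟧≤1 true  = ≤-refl

⟦⟧-true : ∀ {b} → b ≡ true → ⟦ b ⟧ ≡ 1
⟦⟧-true refl = refl

⟦∧⟧ : ∀ a b → ⟦ a ∧ b ⟧ ≡ ⟦ a ⟧ * ⟦ b ⟧
⟦∧⟧ false b     = refl
⟦∧⟧ true  false = refl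
⟦∧⟧ true  true  = refl

⟦∧⟧≤ˡ : ∀ a b → ⟦ a ∧ b ⟧ ≤ ⟦ a ⟧
⟦∧⟧≤ˡ false b = z≤n
⟦∧⟧≤ˡ true  b = ⟦⟧≤1 b

⟦∨⟧≤ : ∀ a b → ⟦ a ∨ b ⟧ ≤ ⟦ a ⟧ + ⟦ b ⟧
⟦∨⟧≤ false b = ≤-refl
⟦∨⟧≤ true  b = s≤s z≤n

⟦∨⟧-disjoint : ∀ a b → (a ≡ true → b ≡ false) → ⟦ a ∨ b ⟧ ≡ ⟦ a ⟧ + ⟦ b ⟧
⟦∨⟧-disjoint false b _ = refl
⟦∨⟧-disjoint true  b h rewrite h refl = refl

sumFin≡sum : ∀ {n} (f : Fin n → ℕ) → sumFin f ≡ sum f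
sumFin≡sum {zero}  f = refl
sumFin≡sum {suc n} f = cong (f F.zero +_) (sumFin≡sum (λ i → f (F.suc i)))

sumFin²≡sum² : ∀ {m n} (f : Fin m → Fin n → ℕ) →
  sumFin (λ i → sumFin (λ j → f i j)) ≡ sum (λ i → sum (λ j → f i j))
sumFin²≡sum² f = trans (sumFin≡sum (λ i → sumFin (f i))) (sum-cong-≗ (λ i → sumFin≡sum (f i)))

sum-cong : ∀ {n} {f g : Fin n → ℕ} → (∀ i → f i ≡ g i) → sumFin f ≡ sumFin g
sum-cong {zero}  e = refl
sum-cong {suc n} e = cong₂ _+_ (e F.zero) (sum-cong (λ i → e (F.suc i)))

sum-mono : ∀ {n} {f g : Fin n → ℕ} → (∀ i → f i ≤ g i) → sumFin f ≤ sumFin g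
sum-mono {zero}  e = z≤n
sum-mono {suc n} e = +-mono-≤ (e F.zero) (sum-mono (λ i → e (F.suc i)))

sum-+ : ∀ {n} (f g : Fin n → ℕ) → sumFin (λ i → f i + g i) ≡ sumFin f + sumFin g
sum-+ f g = begin
  sumFin (λ i → f i + g i)  ≡⟨ sumFin≡sum (λ i → f i + g i) ⟩
  sum (λ i → f i + g i)     ≡⟨ ∑-distrib-+ f g ⟩
  sum f + sum g             ≡⟨ sym (cong₂ _+_ (sumFin≡sum f) (sumFin≡sum g)) ⟩
  sumFin f + sumFin g       ∎
  where open ≡-Reasoning

sum-*ˡ : ∀ {n} (c : ℕ) (f : Fin n → ℕ) → sumFin (λ i → c * f i) ≡ c * sumFin f
sum-*ˡ c f = begin
  sumFin (λ i → c * f i)  ≡⟨ sumFin≡sum (λ i → c * f i) ⟩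
  sum (λ i → c * f i)     ≡⟨ sym (*-distribˡ-sum c f) ⟩
  c * sum f               ≡⟨ cong (c *_) (sym (sumFin≡sum f)) ⟩
  c * sumFin f            ∎
  where open ≡-Reasoning

sum-swap : ∀ {m n} (f : Fin m → Fin n → ℕ) →
  sumFin (λ i → sumFin (λ j → f i j)) ≡ sumFin (λ j → sumFin (λ i → f i j))
sum-swap f = begin
  sumFin (λ i → sumFin (λ j → f i j))  ≡⟨ sumFin²≡sum² f ⟩
  sum (λ i → sum (λ j → f i j))        ≡⟨ ∑-comm f ⟩
  sum (λ j → sum (λ i → f i j))        ≡⟨ sym (sumFin²≡sum² (λ j i → f i j)) ⟩
  sumFin (λ j → sumFin (λ i → f i j))  ∎
  where open ≡-Reasoning

sum-const : ∀ n (c : ℕ) → sumFin {n} (λ _ → c) ≡ n * c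
sum-const zero    c = refl
sum-const (suc n) c = cong (c +_) (sum-const n c)

sum-elem : ∀ {n} (f : Fin n → ℕ) (i : Fin n) → f i ≤ sumFin f
sum-elem f F.zero    = m≤m+n _ _
sum-elem f (F.suc i) = ≤-trans (sum-elem (λ k → f (F.suc k)) i) (m≤n+m _ _)

sum-zero : ∀ {n} (f : Fin n → ℕ) → (∀ i → f i ≡ 0) → sumFin f ≡ 0
sum-zero {n} f z = trans (sum-cong z) (trans (sum-const n 0) (*-zeroʳ n))

sum-le1 : ∀ {n} (f : Fin n → ℕ) → (∀ i → f i ≤ 1) →
          (∀ i j → 1 ≤ f i → 1 ≤ f j → i ≡ j) → sumFin f ≤ 1
sum-le1 {zero}  f b u = z≤n
sum-le1 {suc n} f b u with f F.zero | b F.zero | inspect f F.zero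
... | zero | _ | _ =
  sum-le1 (λ i → f (F.suc i)) (λ i → b (F.suc i)) (λ i j p q → Fsuc-injective (u (F.suc i) (F.suc j) p q))
... | suc zero | _ | [ eq ] = ≤-reflexive (cong suc (sum-zero _ rest-zero))
  where
  rest-zero : ∀ i → f (F.suc i) ≡ 0
  rest-zero i with f (F.suc i) | b (F.suc i) | inspect f (F.suc i)
  ... | zero     | _ | _ = refl
  ... | suc zero | _ | [ e ] with u F.zero (F.suc i) (≤-reflexive (sym eq)) (≤-reflexive (sym e))
  ... | ()
  rest-zero i | suc (suc _) | s≤s () | _
... | suc (suc k) | s≤s () | _

ΣV : ∀ {m n} → (Vertex m n → ℕ) → ℕ
ΣV f = sumFin (λ i → sumFin (λ j → f (i , j)))

ΣV-cong : ∀ {m n} {f g : Vertex m n → ℕ} → (∀ v → f v ≡ g v) → ΣV f ≡ ΣV g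
ΣV-cong e = sum-cong (λ i → sum-cong (λ j → e (i , j)))

ΣV-mono : ∀ {m n} {f g : Vertex m n → ℕ} → (∀ v → f v ≤ g v) → ΣV f ≤ ΣV g
ΣV-mono e = sum-mono (λ i → sum-mono (λ j → e (i , j)))

ΣV-+ : ∀ {m n} (f g : Vertex m n → ℕ) → ΣV (λ v → f v + g v) ≡ ΣV f + ΣV g
ΣV-+ f g = trans (sum-cong (λ i → sum-+ (λ j → f (i , j)) (λ j → g (i , j))))
                 (sum-+ (λ i → sumFin (λ j → f (i , j))) (λ i → sumFin (λ j → g (i , j))))

ΣV-*ˡ : ∀ {m n} (c : ℕ) (f : Vertex m n → ℕ) → ΣV (λ v → c * f v) ≡ c * ΣV f
ΣV-*ˡ c f = trans (sum-cong (λ i → sum-*ˡ c (λ j → f (i , j))))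
                  (sum-*ˡ c (λ i → sumFin (λ j → f (i , j))))

ΣV-elem : ∀ {m n} (f : Vertex m n → ℕ) (v : Vertex m n) → f v ≤ ΣV f
ΣV-elem f (i , j) = ≤-trans (sum-elem (λ j → f (i , j)) j) (sum-elem (λ i → sumFin (λ j → f (i , j))) i)

ΣV-const : ∀ m n (c : ℕ) → ΣV {m} {n} (λ _ → c) ≡ m * (n * c)
ΣV-const m n c = trans (sum-cong {m} (λ i → sum-const n c)) (sum-const m _)

ΣV-swap : ∀ {m n} (f : Vertex m n → Vertex m n → ℕ) →
  ΣV (λ u → ΣV (λ w → f u w)) ≡ ΣV (λ w → ΣV (λ u → f u w))
ΣV-swap f = begin
  ΣV (λ u → ΣV (λ w → f u w))
    ≡⟨ sum-cong (λ i → trans (sum-swap (λ j i' → sumFin (λ j' → f (i , j) (i' , j'))))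
                             (sum-cong (λ i' → sum-swap (λ j j' → f (i , j) (i' , j'))))) ⟩
  sumFin (λ i → sumFin (λ i' → sumFin (λ j' → sumFin (λ j → f (i , j) (i' , j')))))
    ≡⟨ sum-swap (λ i i' → sumFin (λ j' → sumFin (λ j → f (i , j) (i' , j')))) ⟩
  sumFin (λ i' → sumFin (λ i → sumFin (λ j' → sumFin (λ j → f (i , j) (i' , j')))))
    ≡⟨ sum-cong (λ i' → sum-swap (λ i j' → sumFin (λ j → f (i , j) (i' , j')))) ⟩
  ΣV (λ w → ΣV (λ u → f u w)) ∎
  where open ≡-Reasoning

ΣV-le1 : ∀ {m n} (p : Vertex m n → Bool) →
  (∀ v w → p v ≡ true → p w ≡ true → v ≡ w) → ΣV (λ v → ⟦ p v ⟧) ≤ 1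
ΣV-le1 {m} {n} p u =
  sum-le1 _ (λ i → sum-le1 _ (λ j → ⟦⟧≤1 (p (i , j))) (λ j j' a b → cong proj₂ (u _ _ (pos a) (pos b))))
    (λ i i' a b → cong proj₁ (u _ _ (proj₂ (witness i a)) (proj₂ (witness i' b))))
  where
  pos : ∀ {b} → 1 ≤ ⟦ b ⟧ → b ≡ true
  pos {true} _ = refl
  pos {false} ()
  witness : ∀ i → 1 ≤ sumFin (λ j → ⟦ p (i , j) ⟧) → ∃ λ j → p (i , j) ≡ true
  witness i h with any? {n} (λ j → p (i , j) ≟B true)
  ... | yes e = e
  ... | no ne = ⊥-elim (<-irrefl refl (≤-trans h (≤-reflexive (sum-zero _ none))))
    where
    none : ∀ j → ⟦ p (i , j) ⟧ ≡ 0
    none j with p (i , j) in e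
    ... | false = refl
    ... | true  = ⊥-elim (ne (j , e))

true⇒T : ∀ {b} → b ≡ true → T b
true⇒T = Equivalence.from T-≡

T⇒true : ∀ {b} → T b → b ≡ true
T⇒true = Equivalence.to T-≡

≡ᵇ-sound : ∀ a b → (a ≡ᵇ b) ≡ true → a ≡ b
≡ᵇ-sound a b e = ≡ᵇ⇒≡ a b (true⇒T e)

≡ᵇ-refl : ∀ a → (a ≡ᵇ a) ≡ true
≡ᵇ-refl a = T⇒true (≡⇒≡ᵇ a a refl)

≡ᵇ-false : ∀ a b → a ≢ b → (a ≡ᵇ b) ≡ false
≡ᵇ-false a b ne with a ≡ᵇ b in e
... | true  = ⊥-elim (ne (≡ᵇ-sound a b e))
... | false = refl

<ᵇ-sound : ∀ a b → (a <ᵇ b) ≡ true → a < b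
<ᵇ-sound a b e = <ᵇ⇒< a b (true⇒T e)

<ᵇ-complete : ∀ {a b} → a < b → (a <ᵇ b) ≡ true
<ᵇ-complete p = T⇒true (<⇒<ᵇ p)

≤ᵇ-sound : ∀ a b → (a ≤ᵇ b) ≡ true → a ≤ b
≤ᵇ-sound a b e = ≤ᵇ⇒≤ a b (true⇒T e)

≤ᵇ-complete : ∀ {a b} → a ≤ b → (a ≤ᵇ b) ≡ true
≤ᵇ-complete p = T⇒true (≤⇒≤ᵇ p)

≤ᵇ-false : ∀ a b → b < a → (a ≤ᵇ b) ≡ false
≤ᵇ-false a b p with a ≤ᵇ b in e
... | true  = ⊥-elim (<⇒≱ p (≤ᵇ-sound a b e))
... | false = refl

∧-elim₂ : ∀ a b → a ∧ b ≡ true → a ≡ true × b ≡ true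
∧-elim₂ true true _ = refl , refl

∧-elim₃ : ∀ a b c → a ∧ b ∧ c ≡ true → a ≡ true × b ≡ true × c ≡ true
∧-elim₃ true true true _ = refl , refl , refl

∧-intro₂ : ∀ {a b} → a ≡ true → b ≡ true → a ∧ b ≡ true
∧-intro₂ refl refl = refl

∧-intro₃ : ∀ {a b c} → a ≡ true → b ≡ true → c ≡ true → a ∧ b ∧ c ≡ true
∧-intro₃ refl refl refl = refl

∨-elim : ∀ {a b} → a ∨ b ≡ true → a ≡ true ⊎ b ≡ true
∨-elim {true}  _ = inj₁ refl
∨-elim {false} e = inj₂ e

∨-introˡ : ∀ {a} b → a ≡ true → a ∨ b ≡ true
∨-introˡ b refl = refl

∨-introʳ : ∀ a {b} → b ≡ true → a ∨ b ≡ true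
∨-introʳ false e = e
∨-introʳ true  e = refl

sucMod-injective : ∀ m a b → sucMod m a ≡ sucMod m b → a ≡ b
sucMod-injective m a b e with suc a ≡ᵇ m in p | suc b ≡ᵇ m in q
... | true  | true  = suc-injective (trans (≡ᵇ-sound (suc a) m p) (sym (≡ᵇ-sound (suc b) m q)))
... | false | false = suc-injective e
... | true  | false = ⊥-elim (0≢1+n e)
... | false | true  = ⊥-elim (0≢1+n (sym e))

vertex-≡ : ∀ {m n} {v w : Vertex m n} →
  toℕ (proj₁ v) ≡ toℕ (proj₁ w) → toℕ (proj₂ v) ≡ toℕ (proj₂ w) → v ≡ w
vertex-≡ {v = _ , _} {w = _ , _} p q = cong₂ _,_ (toℕ-injective p) (toℕ-injective q)

-- adj u w splits into four tests — w is the vertex below u, the vertex to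
-- the right of u (possibly across the twisted seam), or u is below / to the
-- right of w — and each test holds for at most one w
module Degree {m n : ℕ} (u : Vertex m n) where
  private
    a = toℕ (proj₁ u)
    b = toℕ (proj₂ u)
    x : Vertex m n → ℕ
    x w = toℕ (proj₁ w)
    y : Vertex m n → ℕ
    y w = toℕ (proj₂ w)

  isBelow isRight isAbove isLeft : Vertex m n → Bool
  isBelow w = (x w ≡ᵇ sucMod m a) ∧ (y w ≡ᵇ b)
  isRight w = ((x w ≡ᵇ a) ∧ (suc b <ᵇ n) ∧ (y w ≡ᵇ suc b))
            ∨ ((suc b ≡ᵇ n) ∧ (y w ≡ᵇ 0) ∧ (x w ≡ᵇ sucMod m a))
  isAbove w = (a ≡ᵇ sucMod m (x w)) ∧ (b ≡ᵇ y w)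
  isLeft  w = ((a ≡ᵇ x w) ∧ (suc (y w) <ᵇ n) ∧ (b ≡ᵇ suc (y w)))
            ∨ ((suc (y w) ≡ᵇ n) ∧ (b ≡ᵇ 0) ∧ (a ≡ᵇ sucMod m (x w)))

  adj-split : ∀ w → ⟦ adj u w ⟧ ≤ (⟦ isBelow w ⟧ + ⟦ isRight w ⟧) + (⟦ isAbove w ⟧ + ⟦ isLeft w ⟧)
  adj-split w = ≤-trans (⟦∨⟧≤ (isBelow w ∨ isRight w) (isAbove w ∨ isLeft w))
                        (+-mono-≤ (⟦∨⟧≤ (isBelow w) (isRight w)) (⟦∨⟧≤ (isAbove w) (isLeft w)))

  below-unique : ∀ v w → isBelow v ≡ true → isBelow w ≡ true → v ≡ w
  below-unique v w p q with ∧-elim₂ (x v ≡ᵇ sucMod m a) _ p | ∧-elim₂ (x w ≡ᵇ sucMod m a) _ q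
  ... | p1 , p2 | q1 , q2 =
    vertex-≡ (trans (≡ᵇ-sound (x v) _ p1) (sym (≡ᵇ-sound (x w) _ q1)))
             (trans (≡ᵇ-sound (y v) _ p2) (sym (≡ᵇ-sound (y w) _ q2)))

  above-unique : ∀ v w → isAbove v ≡ true → isAbove w ≡ true → v ≡ w
  above-unique v w p q with ∧-elim₂ (a ≡ᵇ sucMod m (x v)) _ p | ∧-elim₂ (a ≡ᵇ sucMod m (x w)) _ q
  ... | p1 , p2 | q1 , q2 =
    vertex-≡ (sucMod-injective m _ _ (trans (sym (≡ᵇ-sound a _ p1)) (≡ᵇ-sound a _ q1)))
             (trans (sym (≡ᵇ-sound b _ p2)) (≡ᵇ-sound b _ q2))

  -- the two alternatives of isRight exclude each other (b+1 < n versus b+1 = n)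
  right-unique : ∀ v w → isRight v ≡ true → isRight w ≡ true → v ≡ w
  right-unique v w p q with ∨-elim {(x v ≡ᵇ a) ∧ (suc b <ᵇ n) ∧ (y v ≡ᵇ suc b)} p
                          | ∨-elim {(x w ≡ᵇ a) ∧ (suc b <ᵇ n) ∧ (y w ≡ᵇ suc b)} q
  ... | inj₁ p' | inj₁ q'
    with ∧-elim₃ (x v ≡ᵇ a) (suc b <ᵇ n) (y v ≡ᵇ suc b) p' | ∧-elim₃ (x w ≡ᵇ a) (suc b <ᵇ n) (y w ≡ᵇ suc b) q'
  ... | p1 , _ , p3 | q1 , _ , q3 =
    vertex-≡ (trans (≡ᵇ-sound (x v) _ p1) (sym (≡ᵇ-sound (x w) _ q1)))
             (trans (≡ᵇ-sound (y v) _ p3) (sym (≡ᵇ-sound (y w) _ q3)))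
  right-unique v w p q | inj₂ p' | inj₂ q'
    with ∧-elim₃ (suc b ≡ᵇ n) (y v ≡ᵇ 0) (x v ≡ᵇ sucMod m a) p'
      | ∧-elim₃ (suc b ≡ᵇ n) (y w ≡ᵇ 0) (x w ≡ᵇ sucMod m a) q'
  ... | _ , p2 , p3 | _ , q2 , q3 =
    vertex-≡ (trans (≡ᵇ-sound (x v) _ p3) (sym (≡ᵇ-sound (x w) _ q3)))
             (trans (≡ᵇ-sound (y v) _ p2) (sym (≡ᵇ-sound (y w) _ q2)))
  right-unique v w p q | inj₁ p' | inj₂ q'
    with ∧-elim₃ (x v ≡ᵇ a) (suc b <ᵇ n) (y v ≡ᵇ suc b) p'
      | ∧-elim₃ (suc b ≡ᵇ n) (y w ≡ᵇ 0) (x w ≡ᵇ sucMod m a) q'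
  ... | _ , p2 , _ | q1 , _ = ⊥-elim (<-irrefl (≡ᵇ-sound (suc b) n q1) (<ᵇ-sound (suc b) n p2))
  right-unique v w p q | inj₂ p' | inj₁ q'
    with ∧-elim₃ (suc b ≡ᵇ n) (y v ≡ᵇ 0) (x v ≡ᵇ sucMod m a) p'
      | ∧-elim₃ (x w ≡ᵇ a) (suc b <ᵇ n) (y w ≡ᵇ suc b) q'
  ... | p1 , _ | _ , q2 , _ = ⊥-elim (<-irrefl (≡ᵇ-sound (suc b) n p1) (<ᵇ-sound (suc b) n q2))

  -- the two alternatives of isLeft exclude each other (b = y+1 versus b = 0)
  left-unique : ∀ v w → isLeft v ≡ true → isLeft w ≡ true → v ≡ w
  left-unique v w p q with ∨-elim {(a ≡ᵇ x v) ∧ (suc (y v) <ᵇ n) ∧ (b ≡ᵇ suc (y v))} p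
                         | ∨-elim {(a ≡ᵇ x w) ∧ (suc (y w) <ᵇ n) ∧ (b ≡ᵇ suc (y w))} q
  ... | inj₁ p' | inj₁ q'
    with ∧-elim₃ (a ≡ᵇ x v) (suc (y v) <ᵇ n) (b ≡ᵇ suc (y v)) p'
      | ∧-elim₃ (a ≡ᵇ x w) (suc (y w) <ᵇ n) (b ≡ᵇ suc (y w)) q'
  ... | p1 , _ , p3 | q1 , _ , q3 =
    vertex-≡ (trans (sym (≡ᵇ-sound a _ p1)) (≡ᵇ-sound a _ q1))
             (suc-injective (trans (sym (≡ᵇ-sound b _ p3)) (≡ᵇ-sound b _ q3)))
  left-unique v w p q | inj₂ p' | inj₂ q'
    with ∧-elim₃ (suc (y v) ≡ᵇ n) (b ≡ᵇ 0) (a ≡ᵇ sucMod m (x v)) p'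
      | ∧-elim₃ (suc (y w) ≡ᵇ n) (b ≡ᵇ 0) (a ≡ᵇ sucMod m (x w)) q'
  ... | p1 , _ , p3 | q1 , _ , q3 =
    vertex-≡ (sucMod-injective m _ _ (trans (sym (≡ᵇ-sound a _ p3)) (≡ᵇ-sound a _ q3)))
             (suc-injective (trans (≡ᵇ-sound (suc (y v)) n p1) (sym (≡ᵇ-sound (suc (y w)) n q1))))
  left-unique v w p q | inj₁ p' | inj₂ q'
    with ∧-elim₃ (a ≡ᵇ x v) (suc (y v) <ᵇ n) (b ≡ᵇ suc (y v)) p'
      | ∧-elim₃ (suc (y w) ≡ᵇ n) (b ≡ᵇ 0) (a ≡ᵇ sucMod m (x w)) q'
  ... | _ , _ , p3 | _ , q2 , _ = ⊥-elim (0≢1+n (trans (sym (≡ᵇ-sound b 0 q2)) (≡ᵇ-sound b (suc (y v)) p3)))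
  left-unique v w p q | inj₂ p' | inj₁ q'
    with ∧-elim₃ (suc (y v) ≡ᵇ n) (b ≡ᵇ 0) (a ≡ᵇ sucMod m (x v)) p'
      | ∧-elim₃ (a ≡ᵇ x w) (suc (y w) <ᵇ n) (b ≡ᵇ suc (y w)) q'
  ... | _ , p2 , _ | _ , _ , q3 = ⊥-elim (0≢1+n (trans (sym (≡ᵇ-sound b 0 p2)) (≡ᵇ-sound b (suc (y w)) q3)))

  degree≤4 : ΣV (λ w → ⟦ adj u w ⟧) ≤ 4
  degree≤4 = begin
    ΣV (λ w → ⟦ adj u w ⟧)
      ≤⟨ ΣV-mono adj-split ⟩
    ΣV (λ w → (⟦ isBelow w ⟧ + ⟦ isRight w ⟧) + (⟦ isAbove w ⟧ + ⟦ isLeft w ⟧))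
      ≡⟨ ΣV-+ (λ w → ⟦ isBelow w ⟧ + ⟦ isRight w ⟧) (λ w → ⟦ isAbove w ⟧ + ⟦ isLeft w ⟧) ⟩
    ΣV (λ w → ⟦ isBelow w ⟧ + ⟦ isRight w ⟧) + ΣV (λ w → ⟦ isAbove w ⟧ + ⟦ isLeft w ⟧)
      ≡⟨ cong₂ _+_ (ΣV-+ (λ w → ⟦ isBelow w ⟧) (λ w → ⟦ isRight w ⟧))
                   (ΣV-+ (λ w → ⟦ isAbove w ⟧) (λ w → ⟦ isLeft w ⟧)) ⟩
    (ΣV (λ w → ⟦ isBelow w ⟧) + ΣV (λ w → ⟦ isRight w ⟧)) + (ΣV (λ w → ⟦ isAbove w ⟧) + ΣV (λ w → ⟦ isLeft w ⟧))
      ≤⟨ +-mono-≤ (+-mono-≤ (ΣV-le1 isBelow below-unique) (ΣV-le1 isRight right-unique))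
                  (+-mono-≤ (ΣV-le1 isAbove above-unique) (ΣV-le1 isLeft left-unique)) ⟩
    4 ∎
    where open ≤-Reasoning

open Degree using (degree≤4)

-- Lower bound: every percolating seed of (C_m ⊘ C_{3s}, 3) has ≥ ms+1 vertices

module _ {m n : ℕ} where

  links : VSet m n → VSet m n → ℕ
  links X Y = ΣV (λ u → ⟦ X u ⟧ * activeNbrs Y u)

  adj-sym : ∀ (u w : Vertex m n) → adj u w ≡ adj w u
  adj-sym (i , j) (i' , j') = ∨-comm (edgeC m n (toℕ i) (toℕ j) (toℕ i') (toℕ j')) _

  activeNbrs-as-sum : ∀ (Y : VSet m n) u → activeNbrs Y u ≡ ΣV (λ w → ⟦ adj u w ⟧ * ⟦ Y w ⟧)
  activeNbrs-as-sum Y u = ΣV-cong (λ w → ⟦∧⟧ (adj u w) (Y w))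

  activeNbrs≤4 : ∀ (Y : VSet m n) u → activeNbrs Y u ≤ 4
  activeNbrs≤4 Y u = ≤-trans (ΣV-mono (λ w → ⟦∧⟧≤ˡ (adj u w) (Y w))) (degree≤4 u)

  _≐_⊎_ : VSet m n → VSet m n → VSet m n → Set
  Y ≐ Y₁ ⊎ Y₂ = ∀ w → ⟦ Y w ⟧ ≡ ⟦ Y₁ w ⟧ + ⟦ Y₂ w ⟧

  activeNbrs-split : ∀ {Y Y₁ Y₂} → Y ≐ Y₁ ⊎ Y₂ → ∀ u → activeNbrs Y u ≡ activeNbrs Y₁ u + activeNbrs Y₂ u
  activeNbrs-split {Y} {Y₁} {Y₂} h u = begin
    activeNbrs Y u                                                   ≡⟨ activeNbrs-as-sum Y u ⟩
    ΣV (λ w → ⟦ adj u w ⟧ * ⟦ Y w ⟧)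
      ≡⟨ ΣV-cong (λ w → trans (cong (⟦ adj u w ⟧ *_) (h w)) (*-distribˡ-+ ⟦ adj u w ⟧ _ _)) ⟩
    ΣV (λ w → ⟦ adj u w ⟧ * ⟦ Y₁ w ⟧ + ⟦ adj u w ⟧ * ⟦ Y₂ w ⟧)
      ≡⟨ ΣV-+ (λ w → ⟦ adj u w ⟧ * ⟦ Y₁ w ⟧) (λ w → ⟦ adj u w ⟧ * ⟦ Y₂ w ⟧) ⟩
    ΣV (λ w → ⟦ adj u w ⟧ * ⟦ Y₁ w ⟧) + ΣV (λ w → ⟦ adj u w ⟧ * ⟦ Y₂ w ⟧)
      ≡⟨ sym (cong₂ _+_ (activeNbrs-as-sum Y₁ u) (activeNbrs-as-sum Y₂ u)) ⟩
    activeNbrs Y₁ u + activeNbrs Y₂ u                                ∎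
    where open ≡-Reasoning

  links-splitʳ : ∀ X {Y Y₁ Y₂} → Y ≐ Y₁ ⊎ Y₂ → links X Y ≡ links X Y₁ + links X Y₂
  links-splitʳ X {Y} {Y₁} {Y₂} h =
    trans (ΣV-cong (λ u → trans (cong (⟦ X u ⟧ *_) (activeNbrs-split h u)) (*-distribˡ-+ ⟦ X u ⟧ _ _)))
          (ΣV-+ (λ u → ⟦ X u ⟧ * activeNbrs Y₁ u) (λ u → ⟦ X u ⟧ * activeNbrs Y₂ u))

  links-splitˡ : ∀ {X X₁ X₂} Y → X ≐ X₁ ⊎ X₂ → links X Y ≡ links X₁ Y + links X₂ Y
  links-splitˡ {X} {X₁} {X₂} Y h =
    trans (ΣV-cong (λ u → trans (cong (_* activeNbrs Y u) (h u)) (*-distribʳ-+ (activeNbrs Y u) ⟦ X₁ u ⟧ _)))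
          (ΣV-+ (λ u → ⟦ X₁ u ⟧ * activeNbrs Y u) (λ u → ⟦ X₂ u ⟧ * activeNbrs Y u))

  links-as-sum : ∀ X Y → links X Y ≡ ΣV (λ u → ΣV (λ w → ⟦ X u ⟧ * (⟦ adj u w ⟧ * ⟦ Y w ⟧)))
  links-as-sum X Y = ΣV-cong (λ u → trans (cong (⟦ X u ⟧ *_) (activeNbrs-as-sum Y u))
                                         (sym (ΣV-*ˡ ⟦ X u ⟧ (λ w → ⟦ adj u w ⟧ * ⟦ Y w ⟧))))

  links-sym : ∀ X Y → links X Y ≡ links Y X
  links-sym X Y = begin
    links X Y
      ≡⟨ links-as-sum X Y ⟩
    ΣV (λ u → ΣV (λ w → ⟦ X u ⟧ * (⟦ adj u w ⟧ * ⟦ Y w ⟧)))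
      ≡⟨ ΣV-swap (λ u w → ⟦ X u ⟧ * (⟦ adj u w ⟧ * ⟦ Y w ⟧)) ⟩
    ΣV (λ w → ΣV (λ u → ⟦ X u ⟧ * (⟦ adj u w ⟧ * ⟦ Y w ⟧)))
      ≡⟨ ΣV-cong (λ w → ΣV-cong (λ u → trans (rotate ⟦ X u ⟧ ⟦ adj u w ⟧ ⟦ Y w ⟧)
                                              (cong (λ z → ⟦ Y w ⟧ * (⟦ z ⟧ * ⟦ X u ⟧)) (adj-sym u w)))) ⟩
    ΣV (λ w → ΣV (λ u → ⟦ Y w ⟧ * (⟦ adj w u ⟧ * ⟦ X u ⟧)))
      ≡⟨ sym (links-as-sum Y X) ⟩
    links Y X ∎
    where
    open ≡-Reasoning
    rotate : ∀ a b c → a * (b * c) ≡ c * (b * a)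
    rotate = solve-∀

  newlyActive : VSet m n → VSet m n
  newlyActive A u = not (A u) ∧ (3 ≤ᵇ activeNbrs A u)

  step-split : ∀ (A : VSet m n) → step 3 A ≐ A ⊎ newlyActive A
  step-split A u with A u
  ... | true  = refl
  ... | false = refl

  size-split : ∀ (A : VSet m n) → size (step 3 A) ≡ size A + size (newlyActive A)
  size-split A = trans (ΣV-cong (step-split A)) (ΣV-+ (λ v → ⟦ A v ⟧) (λ v → ⟦ newlyActive A v ⟧))

  newlyActive-links : ∀ (A : VSet m n) → 3 * size (newlyActive A) ≤ links (newlyActive A) A
  newlyActive-links A =
    ≤-trans (≤-reflexive (sym (ΣV-*ˡ 3 (λ v → ⟦ newlyActive A v ⟧)))) (ΣV-mono three)
    where
    three : ∀ u → 3 * ⟦ newlyActive A u ⟧ ≤ ⟦ newlyActive A u ⟧ * activeNbrs A u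
    three u with A u
    ... | true = z≤n
    ... | false with 3 ≤ᵇ activeNbrs A u in eq
    ... | false = z≤n
    ... | true  = ≤-trans (≤ᵇ-sound 3 _ eq) (≤-reflexive (sym (+-identityʳ _)))

  -- links inside the next active set: those of A, plus those between D and A
  -- counted in both directions (links inside D are dropped)
  links-step : ∀ (A : VSet m n) →
    links A A + 2 * links (newlyActive A) A ≤ links (step 3 A) (step 3 A)
  links-step A = begin
    links A A + 2 * links D A            ≡⟨ double (links A A) (links D A) ⟩
    links A A + links D A + (links D A + 0)
      ≤⟨ +-mono-≤ (≤-reflexive (cong (links A A +_) (links-sym D A))) (+-monoʳ-≤ (links D A) z≤n) ⟩
    links A A + links A D + (links D A + links D D)
      ≡⟨ sym (cong₂ _+_ (links-splitʳ A (step-split A)) (links-splitʳ D (step-split A))) ⟩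
    links A A' + links D A'              ≡⟨ sym (links-splitˡ {X₁ = A} {D} A' (step-split A)) ⟩
    links A' A'                          ∎
    where
    open ≤-Reasoning
    D = newlyActive A
    A' = step 3 A
    double : ∀ a b → a + 2 * b ≡ a + b + (b + 0)
    double = solve-∀

  -- the potential 6|A| − links(A,A) never exceeds its initial value 6|S|
  PotentialBound : VSet m n → VSet m n → Set
  PotentialBound S A = 6 * size A ≤ links A A + 6 * size S

  potential-step : ∀ S A → PotentialBound S A → PotentialBound S (step 3 A)
  potential-step S A h = begin
    6 * size (step 3 A)                  ≡⟨ cong (6 *_) (size-split A) ⟩
    6 * (size A + size D)                ≡⟨ *-distribˡ-+ 6 (size A) (size D) ⟩
    6 * size A + 6 * size D              ≤⟨ +-monoˡ-≤ (6 * size D) h ⟩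
    links A A + 6 * size S + 6 * size D  ≡⟨ regroup (links A A) (size S) (size D) ⟩
    links A A + 2 * (3 * size D) + 6 * size S
      ≤⟨ +-monoˡ-≤ (6 * size S) (+-monoʳ-≤ (links A A) (*-monoʳ-≤ 2 (newlyActive-links A))) ⟩
    links A A + 2 * links D A + 6 * size S  ≤⟨ +-monoˡ-≤ (6 * size S) (links-step A) ⟩
    links (step 3 A) (step 3 A) + 6 * size S ∎
    where
    open ≤-Reasoning
    D = newlyActive A
    regroup : ∀ a b c → a + 6 * b + 6 * c ≡ a + 2 * (3 * c) + 6 * b
    regroup = solve-∀

  potential-bound : ∀ S t → PotentialBound S (activeAt 3 S t)
  potential-bound S zero    = m≤n+m (6 * size S) (links S S)
  potential-bound S (suc t) = potential-step S (activeAt 3 S t) (potential-bound S t)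

  -- if one step activates everything, degrees ≤ 4 bound the links of A
  last-step-bound : ∀ (A : VSet m n) → (∀ v → step 3 A v ≡ true) →
    links A A + 3 * size (newlyActive A) ≤ 4 * size A
  last-step-bound A full = begin
    links A A + 3 * size D   ≤⟨ +-monoʳ-≤ (links A A) (newlyActive-links A) ⟩
    links A A + links D A    ≡⟨ cong (links A A +_) (links-sym D A) ⟩
    links A A + links A D    ≡⟨ sym (links-splitʳ A (step-split A)) ⟩
    links A A'               ≤⟨ ΣV-mono (λ u → *-monoʳ-≤ ⟦ A u ⟧ (activeNbrs≤4 A' u)) ⟩
    ΣV (λ u → ⟦ A u ⟧ * 4)  ≡⟨ ΣV-cong (λ u → *-comm ⟦ A u ⟧ 4) ⟩
    ΣV (λ u → 4 * ⟦ A u ⟧)  ≡⟨ ΣV-*ˡ 4 (λ u → ⟦ A u ⟧) ⟩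
    4 * size A               ∎
    where
    open ≤-Reasoning
    D = newlyActive A
    A' = step 3 A

  size-full : ∀ (A : VSet m n) → (∀ v → A v ≡ true) → size A ≡ m * (n * 1)
  size-full A h = trans (ΣV-cong (λ v → ⟦⟧-true (h v))) (ΣV-const m n 1)

  size-pos : ∀ (A : VSet m n) v → A v ≡ true → 1 ≤ size A
  size-pos A v h = ≤-trans (≤-reflexive (sym (⟦⟧-true h))) (ΣV-elem (λ v → ⟦ A v ⟧) v)

  full? : (A : VSet m n) → Dec (∀ v → A v ≡ true)
  full? A with all? {m} (λ i → all? {n} (λ j → A (i , j) ≟B true))
  ... | yes p = yes (λ { (i , j) → p i j })
  ... | no np = no (λ p → np (λ i j → p (i , j)))

  not-full : (A : VSet m n) → ¬ (∀ v → A v ≡ true) → ∃ λ v → A v ≡ false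
  not-full A np with ¬∀⟶∃¬ m _ (λ i → all? {n} (λ j → A (i , j) ≟B true)) (λ p → np (λ { (i , j) → p i j }))
  ... | i , ni with ¬∀⟶∃¬ n _ (λ j → A (i , j) ≟B true) ni
  ... | j , nj with A (i , j) in eq
  ... | true  = ⊥-elim (nj refl)
  ... | false = (i , j) , eq

  last-step : ∀ (S : VSet m n) t → (∀ v → activeAt 3 S t v ≡ true) →
    (∀ v → S v ≡ true)
    ⊎ ∃ λ t' → (∃ λ v → activeAt 3 S t' v ≡ false) × (∀ v → activeAt 3 S (suc t') v ≡ true)
  last-step S zero    h = inj₁ h
  last-step S (suc t) h with full? (activeAt 3 S t)
  ... | yes p = last-step S t p
  ... | no np = inj₂ (t , not-full _ np , h)

-- the arithmetic core: with |S| = σ, |A| = α, |D| = δ, links(A,A) = e,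
-- the potential bound, the last-step bound and α + δ = 3q, δ ≥ 1 give σ > q
lower-bound-arith : ∀ σ α δ e q → 6 * α ≤ e + 6 * σ → e + 3 * δ ≤ 4 * α →
  α + δ ≡ 3 * q → 1 ≤ δ → q + 1 ≤ σ
lower-bound-arith σ α δ e q potential last total δ≥1 =
  ≤-trans (≤-reflexive (+-comm q 1)) (*-cancelˡ-< 6 q σ (+-cancelˡ-≤ (e + 4 * α) _ _ key))
  where
  key : (e + 4 * α) + suc (6 * q) ≤ (e + 4 * α) + 6 * σ
  key = begin
    (e + 4 * α) + suc (6 * q)      ≡⟨ cong ((e + 4 * α) +_) (+-comm 1 (6 * q)) ⟩
    (e + 4 * α) + (6 * q + 1)      ≤⟨ +-monoʳ-≤ (e + 4 * α) (+-monoʳ-≤ (6 * q) δ≥1) ⟩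
    (e + 4 * α) + (6 * q + δ)      ≡⟨ cong (λ z → (e + 4 * α) + (z + δ)) (trans (six q) (cong (2 *_) (sym total))) ⟩
    (e + 4 * α) + (2 * (α + δ) + δ) ≡⟨ regroup e α δ ⟩
    6 * α + (e + 3 * δ)            ≤⟨ +-mono-≤ potential last ⟩
    (e + 6 * σ) + 4 * α            ≡⟨ +-comm-middle e (6 * σ) (4 * α) ⟩
    (e + 4 * α) + 6 * σ            ∎
    where
    open ≤-Reasoning
    regroup : ∀ e α δ → (e + 4 * α) + (2 * (α + δ) + δ) ≡ 6 * α + (e + 3 * δ)
    regroup = solve-∀
    six : ∀ q → 6 * q ≡ 2 * (3 * q)
    six = solve-∀
    +-comm-middle : ∀ a b c → (a + b) + c ≡ (a + c) + b
    +-comm-middle = solve-∀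

seed-lower-bound : ∀ m s → 1 ≤ m * s → (S : VSet m (3 * s)) → Percolates 3 S → m * s + 1 ≤ size S
seed-lower-bound m s pos S (t , h) with last-step S t h
... | inj₁ full = begin
  m * s + 1              ≤⟨ +-monoʳ-≤ (m * s) pos ⟩
  m * s + m * s          ≤⟨ m≤m+n (m * s + m * s) (m * s) ⟩
  m * s + m * s + m * s  ≡⟨ three-copies m s ⟩
  m * (3 * s * 1)        ≡⟨ sym (size-full S full) ⟩
  size S                 ∎
  where
  open ≤-Reasoning
  three-copies : ∀ m s → m * s + m * s + m * s ≡ m * (3 * s * 1)
  three-copies = solve-∀
... | inj₂ (t' , (v , inactive) , full) =
  lower-bound-arith (size S) (size A) (size D) (links A A) (m * s)
    (potential-bound S t') (last-step-bound A full)
    (trans (sym (size-split A)) (trans (size-full _ full) (total m s)))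
    (size-pos D v (activated (A v) inactive (full v)))
  where
  A = activeAt 3 S t'
  D = newlyActive A
  activated : ∀ a {x} → a ≡ false → a ∨ x ≡ true → not a ∧ x ≡ true
  activated false _ h = h
  total : ∀ m s → m * (3 * s * 1) ≡ 3 * (m * s)
  total = solve-∀

-- Activation calculus: proving percolation one vertex at a time

-- The eight constructors below name the neighbours used in the schedules:
-- nR/nL right/left, nD/nU down/up, nDw/nUw down/up across the wrap-around
-- from the last row to row 0, nRt/nLt right/left across the twisted seam
-- (i , n−1) — (i+1 , 0).
module Neighbours (m n : ℕ) where

  adjacentℕ : ℕ → ℕ → ℕ → ℕ → Bool
  adjacentℕ i j a b = edgeC m n i j a b ∨ edgeC m n a b i j

  record Nbr (i j : ℕ) : Set where
    constructor mkNbr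
    field
      r c : ℕ
      r< : r < m
      c< : c < n
      adjacent : adjacentℕ i j r c ≡ true
  open Nbr public

  Distinct : ∀ {i j} → Nbr i j → Nbr i j → Set
  Distinct x y = (r x ≢ r y) ⊎ (c x ≢ c y)

  private
    sucMod-< : ∀ {i} → suc i < m → sucMod m i ≡ suc i
    sucMod-< {i} p rewrite ≡ᵇ-false (suc i) m (<⇒≢ p) = refl

    sucMod-last : ∀ {i} → suc i ≡ m → sucMod m i ≡ 0
    sucMod-last {i} e rewrite e | ≡ᵇ-refl m = refl

    sucMod-test : ∀ {i} → suc i < m → (suc i ≡ᵇ sucMod m i) ≡ true
    sucMod-test {i} p = subst (λ z → (suc i ≡ᵇ z) ≡ true) (sym (sucMod-< p)) (≡ᵇ-refl (suc i))

    edgeRight : ∀ {i j} → suc j < n → edgeC m n i j i (suc j) ≡ true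
    edgeRight {i} {j} p = ∨-introʳ ((i ≡ᵇ sucMod m i) ∧ (suc j ≡ᵇ j))
                            (∨-introˡ _ (∧-intro₃ (≡ᵇ-refl i) (<ᵇ-complete p) (≡ᵇ-refl j)))

    edgeDown : ∀ {i j} → suc i < m → edgeC m n i j (suc i) j ≡ true
    edgeDown {i} {j} p = ∨-introˡ _ (∧-intro₂ (sucMod-test p) (≡ᵇ-refl j))

    edgeWrap : ∀ {i j} → suc i ≡ m → edgeC m n i j 0 j ≡ true
    edgeWrap {i} {j} e =
      ∨-introˡ _ (∧-intro₂ (subst (λ z → (0 ≡ᵇ z) ≡ true) (sym (sucMod-last e)) refl) (≡ᵇ-refl j))

    edgeTwist : ∀ {i j} → suc j ≡ n → suc i < m → edgeC m n i j (suc i) 0 ≡ true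
    edgeTwist {i} {j} e p = ∨-introʳ ((suc i ≡ᵇ sucMod m i) ∧ (0 ≡ᵇ j))
       (∨-introʳ ((suc i ≡ᵇ i) ∧ (suc j <ᵇ n) ∧ (0 ≡ᵇ suc j))
         (∧-intro₃ (subst (λ z → (suc j ≡ᵇ z) ≡ true) e (≡ᵇ-refl (suc j))) refl (sucMod-test p)))

  nR : ∀ {i j} → i < m → suc j < n → Nbr i j
  nR {i} {j} p q = mkNbr i (suc j) p q (∨-introˡ _ (edgeRight {i} {j} q))

  nL : ∀ {i j} → i < m → suc j < n → Nbr i (suc j)
  nL {i} {j} p q = mkNbr i j p (<⇒≤ q) (∨-introʳ (edgeC m n i (suc j) i j) (edgeRight {i} {j} q))

  nD : ∀ {i j} → suc i < m → j < n → Nbr i j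
  nD {i} {j} p q = mkNbr (suc i) j p q (∨-introˡ _ (edgeDown {i} {j} p))

  nU : ∀ {i j} → suc i < m → j < n → Nbr (suc i) j
  nU {i} {j} p q = mkNbr i j (<⇒≤ p) q (∨-introʳ (edgeC m n (suc i) j i j) (edgeDown {i} {j} p))

  nDw : ∀ {i j} → suc i ≡ m → j < n → Nbr i j
  nDw {i} {j} e q = mkNbr 0 j (subst (0 <_) e z<s) q (∨-introˡ _ (edgeWrap {i} {j} e))

  nUw : ∀ {i j} → suc i ≡ m → j < n → Nbr 0 j
  nUw {i} {j} e q = mkNbr i j (subst (i <_) e (n<1+n i)) q (∨-introʳ (edgeC m n 0 j i j) (edgeWrap {i} {j} e))

  nRt : ∀ {i j} → suc i < m → suc j ≡ n → Nbr i j
  nRt {i} {j} p e = mkNbr (suc i) 0 p (subst (0 <_) e z<s) (∨-introˡ _ (edgeTwist {i} {j} e p))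

  nLt : ∀ {i j} → suc i < m → suc j ≡ n → Nbr (suc i) 0
  nLt {i} {j} p e =
    mkNbr i j (<⇒≤ p) (subst (j <_) e (n<1+n j)) (∨-introʳ (edgeC m n (suc i) 0 i j) (edgeTwist {i} {j} e p))

module _ {m n : ℕ} where

  _≟V_ : (v w : Vertex m n) → Dec (v ≡ w)
  _≟V_ = ≡-dec _≟F_ _≟F_

  δ : Vertex m n → Vertex m n → ℕ
  δ w v = ⟦ does (v ≟V w) ⟧

  δ-self : ∀ w → δ w w ≡ 1
  δ-self w with w ≟V w
  ... | yes _ = refl
  ... | no ne = ⊥-elim (ne refl)

  δ-count : ∀ w → 1 ≤ ΣV (δ w)
  δ-count w = ≤-trans (≤-reflexive (sym (δ-self w))) (ΣV-elem (δ w) w)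

  three-points : ∀ (p : Vertex m n → Bool) w₁ w₂ w₃ → w₁ ≢ w₂ → w₁ ≢ w₃ → w₂ ≢ w₃ →
    p w₁ ≡ true → p w₂ ≡ true → p w₃ ≡ true → 3 ≤ ΣV (λ v → ⟦ p v ⟧)
  three-points p w₁ w₂ w₃ n12 n13 n23 p1 p2 p3 = begin
    3                                      ≤⟨ +-mono-≤ (δ-count w₁) (+-mono-≤ (δ-count w₂) (δ-count w₃)) ⟩
    ΣV (δ w₁) + (ΣV (δ w₂) + ΣV (δ w₃))   ≡⟨ sym (cong (ΣV (δ w₁) +_) (ΣV-+ (δ w₂) (δ w₃))) ⟩
    ΣV (δ w₁) + ΣV (λ v → δ w₂ v + δ w₃ v) ≡⟨ sym (ΣV-+ (δ w₁) _) ⟩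
    ΣV (λ v → δ w₁ v + (δ w₂ v + δ w₃ v)) ≤⟨ ΣV-mono pointwise ⟩
    ΣV (λ v → ⟦ p v ⟧)                     ∎
    where
    open ≤-Reasoning
    pointwise : ∀ v → δ w₁ v + (δ w₂ v + δ w₃ v) ≤ ⟦ p v ⟧
    pointwise v with v ≟V w₁ | v ≟V w₂ | v ≟V w₃
    ... | yes refl | yes e    | _        = ⊥-elim (n12 e)
    ... | yes refl | no _     | yes e    = ⊥-elim (n13 e)
    ... | yes refl | no _     | no _     = ≤-reflexive (sym (⟦⟧-true p1))
    ... | no _     | yes refl | yes e    = ⊥-elim (n23 e)
    ... | no _     | yes refl | no _     = ≤-reflexive (sym (⟦⟧-true p2))
    ... | no _     | no _     | yes refl = ≤-reflexive (sym (⟦⟧-true p3))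
    ... | no _     | no _     | no _     = z≤n

module Process {m n : ℕ} (S : VSet m n) where
  open Neighbours m n

  activeAt-mono : ∀ {t t'} v → t ≤ t' → activeAt 3 S t v ≡ true → activeAt 3 S t' v ≡ true
  activeAt-mono {t} {t'} v t≤t' h = subst (λ z → activeAt 3 S z v ≡ true) (m∸n+n≡m t≤t') (later (t' ∸ t) h)
    where
    later : ∀ d → activeAt 3 S t v ≡ true → activeAt 3 S (d + t) v ≡ true
    later zero    h = h
    later (suc d) h = ∨-introˡ _ (later d h)

  EventuallyActive : Vertex m n → Set
  EventuallyActive v = ∃ λ t → activeAt 3 S t v ≡ true

  Reached : ℕ → ℕ → Set
  Reached i j = ∀ (v : Vertex m n) → toℕ (proj₁ v) ≡ i → toℕ (proj₂ v) ≡ j → EventuallyActive v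

  three-active-neighbours : ∀ v w₁ w₂ w₃ → w₁ ≢ w₂ → w₁ ≢ w₃ → w₂ ≢ w₃ →
    adj v w₁ ≡ true → adj v w₂ ≡ true → adj v w₃ ≡ true →
    EventuallyActive w₁ → EventuallyActive w₂ → EventuallyActive w₃ → EventuallyActive v
  three-active-neighbours v w₁ w₂ w₃ n12 n13 n23 a1 a2 a3 (t₁ , h₁) (t₂ , h₂) (t₃ , h₃) =
    suc tEnd , ∨-introʳ (A v) (≤ᵇ-complete (three-points (λ w → adj v w ∧ A w) w₁ w₂ w₃ n12 n13 n23
       (∧-intro₂ a1 (activeAt-mono w₁ l₁ h₁)) (∧-intro₂ a2 (activeAt-mono w₂ l₂ h₂))
       (∧-intro₂ a3 (activeAt-mono w₃ l₃ h₃))))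
    where
    tEnd = t₁ + t₂ + t₃
    A = activeAt 3 S tEnd
    l₁ : t₁ ≤ tEnd
    l₁ = ≤-trans (m≤m+n t₁ t₂) (m≤m+n _ t₃)
    l₂ : t₂ ≤ tEnd
    l₂ = ≤-trans (m≤n+m t₂ t₁) (m≤m+n _ t₃)
    l₃ : t₃ ≤ tEnd
    l₃ = m≤n+m t₃ _

  private
    nbrVertex : ∀ {i j} → Nbr i j → Vertex m n
    nbrVertex x = fromℕ< (r< x) , fromℕ< (c< x)

    nbrVertex-r : ∀ {i j} (x : Nbr i j) → toℕ (proj₁ (nbrVertex x)) ≡ r x
    nbrVertex-r x = toℕ-fromℕ< (r< x)

    nbrVertex-c : ∀ {i j} (x : Nbr i j) → toℕ (proj₂ (nbrVertex x)) ≡ c x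
    nbrVertex-c x = toℕ-fromℕ< (c< x)

    nbrVertex-adj : ∀ {i j} (v : Vertex m n) → toℕ (proj₁ v) ≡ i → toℕ (proj₂ v) ≡ j →
      (x : Nbr i j) → adj v (nbrVertex x) ≡ true
    nbrVertex-adj (a , b) refl refl x rewrite nbrVertex-r x | nbrVertex-c x = adjacent x

    nbrVertex-≢ : ∀ {i j} (x y : Nbr i j) → Distinct x y → nbrVertex x ≢ nbrVertex y
    nbrVertex-≢ x y (inj₁ ne) e =
      ne (trans (sym (nbrVertex-r x)) (trans (cong (λ z → toℕ (proj₁ z)) e) (nbrVertex-r y)))
    nbrVertex-≢ x y (inj₂ ne) e =
      ne (trans (sym (nbrVertex-c x)) (trans (cong (λ z → toℕ (proj₂ z)) e) (nbrVertex-c y)))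

  reach-by-three : ∀ {i j} (x y z : Nbr i j) → Distinct x y → Distinct x z → Distinct y z →
    Reached (r x) (c x) → Reached (r y) (c y) → Reached (r z) (c z) → Reached i j
  reach-by-three x y z dxy dxz dyz ex ey ez v ei ej =
    three-active-neighbours v (nbrVertex x) (nbrVertex y) (nbrVertex z)
      (nbrVertex-≢ x y dxy) (nbrVertex-≢ x z dxz) (nbrVertex-≢ y z dyz)
      (nbrVertex-adj v ei ej x) (nbrVertex-adj v ei ej y) (nbrVertex-adj v ei ej z)
      (ex _ (nbrVertex-r x) (nbrVertex-c x)) (ey _ (nbrVertex-r y) (nbrVertex-c y))
      (ez _ (nbrVertex-r z) (nbrVertex-c z))

  -- a finite set of eventually active vertices is active at one common time
  percolates-if-reached : (∀ i j → i < m → j < n → Reached i j) → Percolates 3 S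
  percolates-if-reached h = tEnd , λ v → activeAt-mono v (ΣV-elem time v) (proj₂ (eventually v))
    where
    eventually : ∀ v → EventuallyActive v
    eventually v = h _ _ (toℕ<n (proj₁ v)) (toℕ<n (proj₂ v)) v refl refl
    time : Vertex m n → ℕ
    time v = proj₁ (eventually v)
    tEnd = ΣV time

tri : ℕ → ℕ
tri zero    = 0
tri (suc k) = suc (suc (suc (tri k)))

c1 c2 : ℕ → ℕ
c1 k = suc (tri k)
c2 k = suc (suc (tri k))

-- dbl t = 2t, with definitional unfolding on suc
dbl : ℕ → ℕ
dbl zero    = 0
dbl (suc t) = suc (suc (dbl t))

tri-mono : ∀ {a b} → a ≤ b → tri a ≤ tri b
tri-mono z≤n     = z≤n
tri-mono (s≤s p) = s≤s (s≤s (s≤s (tri-mono p)))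

c2<tri : ∀ {k s} → k < s → c2 k < tri s
c2<tri p = tri-mono p

data Block (s : ℕ) : ℕ → Set where
  col≡0 : ∀ g → g < s → Block s (tri g)
  col≡1 : ∀ g → g < s → Block s (c1 g)
  col≡2 : ∀ g → g < s → Block s (c2 g)

block : ∀ s j → j < tri s → Block s j
block (suc s) zero                _ = col≡0 0 (s≤s z≤n)
block (suc s) (suc zero)          _ = col≡1 0 (s≤s z≤n)
block (suc s) (suc (suc zero))    _ = col≡2 0 (s≤s z≤n)
block (suc s) (suc (suc (suc j))) (s≤s (s≤s (s≤s j<3s))) with block s j j<3s
... | col≡0 g g<s = col≡0 (suc g) (s≤s g<s)
... | col≡1 g g<s = col≡1 (suc g) (s≤s g<s)
... | col≡2 g g<s = col≡2 (suc g) (s≤s g<s)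

data ParityView : ℕ → Set where
  even : ∀ t → ParityView (dbl t)
  odd  : ∀ t → ParityView (suc (dbl t))

parity-view : ∀ i → ParityView i
parity-view zero = even 0
parity-view (suc i) with parity-view i
... | even t = odd t
... | odd t  = even (suc t)

even-row< : ∀ t B → suc (suc (dbl t)) < suc (suc (suc (suc (dbl B)))) →
  suc (suc (suc (dbl t))) < suc (suc (suc (suc (dbl B))))
even-row< zero    zero    _ = s≤s (s≤s (s≤s (s≤s z≤n)))
even-row< zero    (suc B) _ = s≤s (s≤s (s≤s (s≤s z≤n)))
even-row< (suc t) zero    (s≤s (s≤s (s≤s (s≤s ()))))
even-row< (suc t) (suc B) (s≤s (s≤s p)) = s≤s (s≤s (even-row< t B p))

ne-s : ∀ {x} → x ≢ suc x
ne-s ()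
ne-ss : ∀ {x} → x ≢ suc (suc x)
ne-ss ()
s-ne : ∀ {x} → suc x ≢ x
s-ne ()
ss-ne : ∀ {x} → suc (suc x) ≢ x
ss-ne ()

-- Rows 0 … m−1 (m2 = m−2, mm = m−1), columns 0 … n−1 with n = 3s, and an
-- even row b = 2B+4 ≤ m−1.  Reach is any predicate closed under the
-- threshold rule (reach); the seed is described by hypotheses: row 0
-- contains the columns ≡ 0 (mod 3) and column 1, odd rows < b the columns
-- ≡ 2, even rows 2 … b the columns ≡ 1, row m−1 the columns ≡ 1 and row m−2
-- the columns ≡ 2.  From this,
--  * column 3g fills from row b up to row 1 (column0-top),
--  * then (1,3g+1), (0,3g+1), (0,3g+2) and (m−1,3g+2) follow (top-cells),
--  * knowing (b,3g) and (b,3g+2) for all g gives rows 0 … b (cover-upper),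
--  * knowing (b,3g) and (m−1,3g) for all g gives row m−1 (cover-last).
-- Rows strictly between b and m−1 are handled by the instances below.
module Schedule (m n s' m2 B : ℕ)
  (m≡ : suc (suc m2) ≡ m) (n≡ : tri (suc s') ≡ n)
  (b≤m2+1 : suc (suc (suc (suc (dbl B)))) ≤ suc m2)
  (Reach : ℕ → ℕ → Set)
  (reach : ∀ {i j} (x y z : Neighbours.Nbr m n i j) →
     Neighbours.Distinct m n x y → Neighbours.Distinct m n x z → Neighbours.Distinct m n y z →
     Reach (Neighbours.r x) (Neighbours.c x) → Reach (Neighbours.r y) (Neighbours.c y) →
     Reach (Neighbours.r z) (Neighbours.c z) → Reach i j)
  (seedRow0 : ∀ k → k < suc s' → Reach 0 (tri k))
  (seed01 : Reach 0 1)
  (seedOdd : ∀ t k → suc (dbl t) < suc (suc (suc (suc (dbl B)))) → k < suc s' →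
     Reach (suc (dbl t)) (c2 k))
  (seedEven : ∀ t k → suc (suc (dbl t)) ≤ suc (suc (suc (suc (dbl B)))) → k < suc s' →
     Reach (suc (suc (dbl t))) (c1 k))
  (seedLast : ∀ k → k < suc s' → Reach (suc m2) (c1 k))
  (seedPenult : ∀ k → k < suc s' → Reach m2 (c2 k))
  where
  open Neighbours m n

  s = suc s'
  mm = suc m2
  b = suc (suc (suc (suc (dbl B))))

  row<m : ∀ {i} → i ≤ b → i < m
  row<m p = ≤-trans (s≤s (≤-trans p b≤m2+1)) (≤-reflexive m≡)

  mm<m : mm < m
  mm<m = ≤-reflexive m≡

  m2≢0 : m2 ≢ 0
  m2≢0 e = no-room (subst (λ z → suc (suc (suc (suc (dbl B)))) ≤ suc z) e b≤m2+1)
    where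
    no-room : suc (suc (suc (suc (dbl B)))) ≤ 1 → ⊥
    no-room (s≤s ())

  mm≢1 : mm ≢ 1
  mm≢1 e = m2≢0 (suc-injective e)

  col2<n : ∀ {k} → k < s → c2 k < n
  col2<n p = subst (_ <_) n≡ (c2<tri p)

  col1<n : ∀ {k} → k < s → c1 k < n
  col1<n p = <-trans (n<1+n _) (col2<n p)

  col0<n : ∀ {k} → k < s → tri k < n
  col0<n p = <-trans (n<1+n _) (col1<n p)

  -- the twisted seam joins the last column c2 s' to column 0 of the next row
  last : suc (c2 s') ≡ n
  last = n≡

  k0 : 0 < s
  k0 = s≤s z≤n

  ks' : s' < s
  ks' = n<1+n s'

  b1 : 1 < b
  b1 = s≤s (s≤s z≤n)

  b2 : 2 ≤ b
  b2 = s≤s (s≤s z≤n)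

  reach11 : Reach 1 1
  reach11 = reach (nU {0} {1} (row<m (s≤s z≤n)) (col1<n k0))
                  (nD {1} {1} (row<m b2) (col1<n k0))
                  (nR {1} {1} (row<m (s≤s z≤n)) (col2<n k0))
                  (inj₁ (λ ())) (inj₁ (λ ())) (inj₁ (λ ()))
                  seed01 (seedEven 0 0 b2 k0) (seedOdd 0 0 b1 k0)

  -- inside rows 2 … b−1, a non-seed cell of a column 3g+1 or 3g+2 lies
  -- between two seed cells of the same column and next to a third
  evenRow-col2 : ∀ t k → suc (suc (suc (dbl t))) < b → k < s → Reach (suc (suc (dbl t))) (c2 k)
  evenRow-col2 t k p q =
    reach (nL {suc (suc (dbl t))} {c1 k} (row<m (<⇒≤ (<-trans (n<1+n _) p))) (col2<n q))
          (nU {suc (dbl t)} {c2 k} (row<m (<⇒≤ (<-trans (n<1+n _) p))) (col2<n q))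
          (nD {suc (suc (dbl t))} {c2 k} (row<m (<⇒≤ p)) (col2<n q))
          (inj₁ s-ne) (inj₁ ne-s) (inj₁ ne-ss)
          (seedEven t k (<⇒≤ (<-trans (n<1+n _) p)) q)
          (seedOdd t k (<-trans (n<1+n _) (<-trans (n<1+n _) p)) q)
          (seedOdd (suc t) k p q)

  oddRow-col1 : ∀ t k → suc (suc (suc (dbl t))) < b → k < s → Reach (suc (suc (suc (dbl t)))) (c1 k)
  oddRow-col1 t k p q =
    reach (nR {suc (suc (suc (dbl t)))} {c1 k} (row<m (<⇒≤ p)) (col2<n q))
          (nU {suc (suc (dbl t))} {c1 k} (row<m (<⇒≤ p)) (col1<n q))
          (nD {suc (suc (suc (dbl t)))} {c1 k} (row<m p) (col1<n q))
          (inj₁ s-ne) (inj₁ ne-s) (inj₁ ne-ss)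
          (seedOdd (suc t) k p q)
          (seedEven t k (<⇒≤ (<-trans (n<1+n _) p)) q)
          (seedEven (suc t) k p q)

  -- column 3g moves up one row: the cell below, the seed cell to the right
  -- and the cell to the left (across the seam when g = 0)
  column0-step : ∀ g i → g < s → suc (suc i) < b → Reach (suc (suc (suc i))) (tri g) → Reach (suc (suc i)) (tri g)
  column0-step g i q ib h with parity-view i
  column0-step zero .(dbl t) q ib h | even t =
    reach (nR {suc (suc (dbl t))} {0} (row<m (<⇒≤ ib)) (col1<n q))
          (nD {suc (suc (dbl t))} {0} (row<m ib) (col0<n q))
          (nLt {suc (dbl t)} {c2 s'} (row<m (<⇒≤ ib)) last)
          (inj₁ ne-s) (inj₁ s-ne) (inj₁ ss-ne)
          (seedEven t 0 (<⇒≤ ib) q) h (seedOdd t s' (<-trans (n<1+n _) ib) ks')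
  column0-step (suc g) .(dbl t) q ib h | even t =
    reach (nR {suc (suc (dbl t))} {tri (suc g)} (row<m (<⇒≤ ib)) (col1<n q))
          (nD {suc (suc (dbl t))} {tri (suc g)} (row<m ib) (col0<n q))
          (nL {suc (suc (dbl t))} {c2 g} (row<m (<⇒≤ ib)) (col0<n q))
          (inj₁ ne-s) (inj₂ ss-ne) (inj₁ s-ne)
          (seedEven t (suc g) (<⇒≤ ib) q) h (evenRow-col2 t g (even-row< t B ib) (<-trans (n<1+n _) q))
  column0-step zero .(suc (dbl t)) q ib h | odd t =
    reach (nR {suc (suc (suc (dbl t)))} {0} (row<m (<⇒≤ ib)) (col1<n q))
          (nD {suc (suc (suc (dbl t)))} {0} (row<m ib) (col0<n q))
          (nLt {suc (suc (dbl t))} {c2 s'} (row<m (<⇒≤ ib)) last)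
          (inj₁ ne-s) (inj₁ s-ne) (inj₁ ss-ne)
          (oddRow-col1 t 0 ib q) h (evenRow-col2 t s' ib ks')
  column0-step (suc g) .(suc (dbl t)) q ib h | odd t =
    reach (nR {suc (suc (suc (dbl t)))} {tri (suc g)} (row<m (<⇒≤ ib)) (col1<n q))
          (nD {suc (suc (suc (dbl t)))} {tri (suc g)} (row<m ib) (col0<n q))
          (nL {suc (suc (suc (dbl t)))} {c2 g} (row<m (<⇒≤ ib)) (col0<n q))
          (inj₁ ne-s) (inj₂ ss-ne) (inj₁ s-ne)
          (oddRow-col1 t (suc g) ib q) h (seedOdd (suc t) g ib (<-trans (n<1+n _) q))

  column0-climb : ∀ g → g < s → Reach b (tri g) → ∀ i → suc (suc i) ≤ b → Reach (suc (suc i)) (tri g)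
  column0-climb g q hb i ib = climb (b ∸ suc (suc i)) i (m+[n∸m]≡n ib)
    where
    climb : ∀ d i → suc (suc i) + d ≡ b → Reach (suc (suc i)) (tri g)
    climb zero    i e = subst (λ z → Reach z (tri g)) (sym (trans (sym (+-identityʳ _)) e)) hb
    climb (suc d) i e =
      column0-step g i q (subst (suc (suc i) <_) e (m<m+n _ (s≤s z≤n)))
        (climb d (suc i) (trans (sym (+-suc (suc (suc i)) d)) e))

  column0-row1 : ∀ g → g < s → Reach 2 (tri g) → Reach 1 (tri g)
  column0-row1 zero q h =
    reach (nU {0} {0} (row<m (s≤s z≤n)) (col0<n q))
          (nD {1} {0} (row<m b2) (col0<n q))
          (nR {1} {0} (row<m (s≤s z≤n)) (col1<n q))
          (inj₁ (λ ())) (inj₁ (λ ())) (inj₁ (λ ()))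
          (seedRow0 0 q) h reach11
  column0-row1 (suc g) q h =
    reach (nU {0} {tri (suc g)} (row<m (s≤s z≤n)) (col0<n q))
          (nD {1} {tri (suc g)} (row<m b2) (col0<n q))
          (nL {1} {c2 g} (row<m (s≤s z≤n)) (col0<n q))
          (inj₁ (λ ())) (inj₁ (λ ())) (inj₁ (λ ()))
          (seedRow0 (suc g) q) h (seedOdd 0 g b1 (<-trans (n<1+n _) q))

  column0-top : ∀ g → g < s → Reach b (tri g) → Reach 1 (tri g)
  column0-top g q hb = column0-row1 g q (column0-climb g q hb 0 b2)

  record TopCells (g : ℕ) : Set where
    field
      row1-col1 : Reach 1 (c1 g)
      row0-col1 : Reach 0 (c1 g)
      row0-col2 : Reach 0 (c2 g)
      last-col2 : Reach mm (c2 g)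

  -- the right neighbour of (0, 3g+2): a seed cell, or (1, 0) across the seam
  record RightOfTop (g : ℕ) (q : g < s) : Set where
    field
      nbr      : Nbr 0 (c2 g)
      reached  : Reach (r nbr) (c nbr)
      ≢below   : Distinct nbr (nD {0} {c2 g} (row<m (s≤s z≤n)) (col2<n q))
      ≢left    : Distinct nbr (nL {0} {c1 g} (row<m z≤n) (col2<n q))

  top-cells : ∀ g → g < s → Reach 1 (tri g) → Reach 1 0 → TopCells g
  top-cells g q h reach10 = record
    { row1-col1 = row1-col1 ; row0-col1 = row0-col1 ; row0-col2 = row0-col2 ; last-col2 = last-col2 }
    where
    row1-col1 : Reach 1 (c1 g)
    row1-col1 =
      reach (nR {1} {c1 g} (row<m (s≤s z≤n)) (col2<n q))
            (nD {1} {c1 g} (row<m b2) (col1<n q))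
            (nL {1} {tri g} (row<m (s≤s z≤n)) (col1<n q))
            (inj₁ (λ ())) (inj₂ ss-ne) (inj₁ (λ ()))
            (seedOdd 0 g b1 q) (seedEven 0 g b2 q) h
    row0-col1 : Reach 0 (c1 g)
    row0-col1 =
      reach (nL {0} {tri g} (row<m z≤n) (col1<n q))
            (nUw {mm} {c1 g} m≡ (col1<n q))
            (nD {0} {c1 g} (row<m (s≤s z≤n)) (col1<n q))
            (inj₁ (λ ())) (inj₁ (λ ())) (inj₁ mm≢1)
            (seedRow0 g q) (seedLast g q) row1-col1
    right : RightOfTop g q
    right with suc g ≟ s
    ... | yes e = record
      { nbr = nRt {0} {c2 g} (row<m (s≤s z≤n)) (subst (λ z → suc (c2 z) ≡ n) (sym (suc-injective e)) last)
      ; reached = reach10 ; ≢below = inj₂ (λ ()) ; ≢left = inj₁ (λ ()) }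
    ... | no ne = record
      { nbr = nR {0} {c2 g} (row<m z≤n) (col0<n {suc g} (≤∧≢⇒< q ne))
      ; reached = seedRow0 (suc g) (≤∧≢⇒< q ne) ; ≢below = inj₁ (λ ()) ; ≢left = inj₂ ss-ne }
    row0-col2 : Reach 0 (c2 g)
    row0-col2 =
      reach (RightOfTop.nbr right)
            (nD {0} {c2 g} (row<m (s≤s z≤n)) (col2<n q))
            (nL {0} {c1 g} (row<m z≤n) (col2<n q))
            (RightOfTop.≢below right) (RightOfTop.≢left right) (inj₁ (λ ()))
            (RightOfTop.reached right) (seedOdd 0 g b1 q) row0-col1
    last-col2 : Reach mm (c2 g)
    last-col2 =
      reach (nL {mm} {c1 g} mm<m (col2<n q))
            (nU {m2} {c2 g} mm<m (col2<n q))
            (nDw {mm} {c2 g} m≡ (col2<n q))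
            (inj₁ s-ne) (inj₁ (λ ())) (inj₁ m2≢0)
            (seedLast g q) (seedPenult g q) row0-col2

  -- (m−1, 0) has the seed cells (m−1, 1) to its right, (0, 0) below it across
  -- the wrap-around and (m−2, n−1) to its left across the seam
  lastRow-col0 : Reach mm 0
  lastRow-col0 =
    reach (nR {mm} {0} mm<m (col1<n k0))
          (nDw {mm} {0} m≡ (col0<n k0))
          (nLt {m2} {c2 s'} mm<m last)
          (inj₁ (λ ())) (inj₁ s-ne) (inj₁ (λ e → m2≢0 (sym e)))
          (seedLast 0 k0) (seedRow0 0 k0) (seedPenult s' ks')

  lastRow-next : ∀ g → suc g < s → Reach mm (c2 g) → Reach mm (tri (suc g))
  lastRow-next g q h =
    reach (nL {mm} {c2 g} mm<m (col0<n q))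
          (nR {mm} {tri (suc g)} mm<m (col1<n q))
          (nDw {mm} {tri (suc g)} m≡ (col0<n q))
          (inj₂ ne-ss) (inj₁ (λ ())) (inj₁ (λ ()))
          h (seedLast (suc g) q) (seedRow0 (suc g) q)

  inner-col1 : ∀ i g → g < s → suc (suc i) ≤ b → Reach (suc (suc i)) (c1 g)
  inner-col1 i g q ib with suc (suc i) <? b | parity-view i
  ... | yes i<b | even t = seedEven t g ib q
  ... | yes i<b | odd t  = oddRow-col1 t g i<b q
  ... | no i≮b  | _      = subst (λ z → Reach z (c1 g)) (sym (≤-antisym ib (≮⇒≥ i≮b))) (seedEven (suc B) g ≤-refl q)

  inner-col2 : ∀ i g → Reach b (c2 g) → g < s → suc (suc i) ≤ b → Reach (suc (suc i)) (c2 g)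
  inner-col2 i g hb q ib with suc (suc i) <? b | parity-view i
  ... | yes i<b | even t = evenRow-col2 t g (even-row< t B i<b) q
  ... | yes i<b | odd t  = seedOdd (suc t) g i<b q
  ... | no i≮b  | _      = subst (λ z → Reach z (c2 g)) (sym (≤-antisym ib (≮⇒≥ i≮b))) hb

  column-block : ∀ j → j < n → Block s j
  column-block j p = block s j (subst (j <_) (sym n≡) p)

  cover-upper : (∀ g → g < s → Reach b (tri g)) → (∀ g → g < s → Reach b (c2 g)) →
    ∀ i j → i ≤ b → j < n → Reach i j
  cover-upper reachB-col0 reachB-col2 i j ib jn = go i (column-block j jn) ib
    where
    reach10 : Reach 1 0
    reach10 = column0-top 0 k0 (reachB-col0 0 k0)
    top : ∀ g → g < s → TopCells g
    top g q = top-cells g q (column0-top g q (reachB-col0 g q)) reach10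
    go : ∀ i {j} → Block s j → i ≤ b → Reach i j
    go zero          (col≡0 g q) _  = seedRow0 g q
    go zero          (col≡1 g q) _  = TopCells.row0-col1 (top g q)
    go zero          (col≡2 g q) _  = TopCells.row0-col2 (top g q)
    go (suc zero)    (col≡0 g q) _  = column0-top g q (reachB-col0 g q)
    go (suc zero)    (col≡1 g q) _  = TopCells.row1-col1 (top g q)
    go (suc zero)    (col≡2 g q) _  = seedOdd 0 g b1 q
    go (suc (suc i)) (col≡0 g q) ib = column0-climb g q (reachB-col0 g q) i ib
    go (suc (suc i)) (col≡1 g q) ib = inner-col1 i g q ib
    go (suc (suc i)) (col≡2 g q) ib = inner-col2 i g (reachB-col2 g q) q ib

  cover-last : (∀ g → g < s → Reach b (tri g)) → (∀ g → g < s → Reach mm (tri g)) →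
    ∀ j → j < n → Reach mm j
  cover-last reachB-col0 reachLast-col0 j jn with column-block j jn
  ... | col≡0 g q = reachLast-col0 g q
  ... | col≡1 g q = seedLast g q
  ... | col≡2 g q = TopCells.last-col2 (top-cells g q (column0-top g q (reachB-col0 g q))
                                                    (column0-top 0 k0 (reachB-col0 0 k0)))

-- m = 2B+5 odd: b = m−1 is the last row, and the cells (m−1, 3g) follow one
-- block after another along the last row
module OddSchedule (m n s' B : ℕ)
  (m≡ : suc (suc (suc (suc (suc (dbl B))))) ≡ m) (n≡ : tri (suc s') ≡ n)
  (Reach : ℕ → ℕ → Set)
  (reach : ∀ {i j} (x y z : Neighbours.Nbr m n i j) →
     Neighbours.Distinct m n x y → Neighbours.Distinct m n x z → Neighbours.Distinct m n y z →
     Reach (Neighbours.r x) (Neighbours.c x) → Reach (Neighbours.r y) (Neighbours.c y) →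
     Reach (Neighbours.r z) (Neighbours.c z) → Reach i j)
  (seedRow0 : ∀ k → k < suc s' → Reach 0 (tri k))
  (seed01 : Reach 0 1)
  (seedOdd : ∀ t k → suc (dbl t) < suc (suc (suc (suc (dbl B)))) → k < suc s' →
     Reach (suc (dbl t)) (c2 k))
  (seedEven : ∀ t k → suc (suc (dbl t)) ≤ suc (suc (suc (suc (dbl B)))) → k < suc s' →
     Reach (suc (suc (dbl t))) (c1 k))
  (seedLast : ∀ k → k < suc s' → Reach (suc (suc (suc (suc (dbl B))))) (c1 k))
  (seedPenult : ∀ k → k < suc s' → Reach (suc (suc (suc (dbl B)))) (c2 k))
  where
  open Schedule m n s' (suc (suc (suc (dbl B)))) B m≡ n≡ ≤-refl
                Reach reach seedRow0 seed01 seedOdd seedEven seedLast seedPenult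

  reachB-col0 : ∀ g → g < s → Reach b (tri g)
  reachB-col2 : ∀ g → g < s → Reach b (c2 g)

  reachB-col0 zero    q = lastRow-col0
  reachB-col0 (suc g) q = lastRow-next g q (reachB-col2 g (<-trans (n<1+n g) q))

  reachB-col2 g q = TopCells.last-col2 (top-cells g q (column0-top g q (reachB-col0 g q))
                                                      (column0-top 0 k0 lastRow-col0))

  cover : ∀ i j → i < m → j < n → Reach i j
  cover i j im jn = cover-upper reachB-col0 reachB-col2 i j (≤-pred (subst (i <_) (sym m≡) im)) jn

-- m = 2B+8 even: b = m−4, and rows b+1 (mid), b+2 = m−2, b+3 = m−1 carry the
-- columns ≡ 0, 2, 1 (mod 3).  The cells (b, 3g) and (m−2, 3g+1) activate
-- each other block by block, so everything follows once (m−2, 1) is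
-- reached: this is automatic for s even and needs one more seed vertex
-- for s odd.
module EvenSchedule (m n s' B : ℕ)
  (m≡ : suc (suc (suc (suc (suc (suc (suc (suc (dbl B)))))))) ≡ m) (n≡ : tri (suc s') ≡ n)
  (Reach : ℕ → ℕ → Set)
  (reach : ∀ {i j} (x y z : Neighbours.Nbr m n i j) →
     Neighbours.Distinct m n x y → Neighbours.Distinct m n x z → Neighbours.Distinct m n y z →
     Reach (Neighbours.r x) (Neighbours.c x) → Reach (Neighbours.r y) (Neighbours.c y) →
     Reach (Neighbours.r z) (Neighbours.c z) → Reach i j)
  (seedRow0 : ∀ k → k < suc s' → Reach 0 (tri k))
  (seed01 : Reach 0 1)
  (seedOdd : ∀ t k → suc (dbl t) < suc (suc (suc (suc (dbl B)))) → k < suc s' →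
     Reach (suc (dbl t)) (c2 k))
  (seedEven : ∀ t k → suc (suc (dbl t)) ≤ suc (suc (suc (suc (dbl B)))) → k < suc s' →
     Reach (suc (suc (dbl t))) (c1 k))
  (seedLast : ∀ k → k < suc s' → Reach (suc (suc (suc (suc (suc (suc (suc (dbl B)))))))) (c1 k))
  (seedPenult : ∀ k → k < suc s' → Reach (suc (suc (suc (suc (suc (suc (dbl B))))))) (c2 k))
  (seedMid : ∀ k → k < suc s' → Reach (suc (suc (suc (suc (suc (dbl B)))))) (tri k))
  where
  open Schedule m n s' (suc (suc (suc (suc (suc (suc (dbl B))))))) B m≡ n≡ (m≤n+m _ 3)
                Reach reach seedRow0 seed01 seedOdd seedEven seedLast seedPenult
  open Neighbours m n

  m2 : ℕ
  m2 = suc (suc (suc (suc (suc (suc (dbl B))))))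

  mid : ℕ
  mid = suc b

  penult<m : suc mid < m
  penult<m = <-trans (n<1+n _) mm<m

  mid<m : suc b < m
  mid<m = <-trans (n<1+n _) penult<m

  rowB-col0 : Reach b 0
  rowB-col0 =
    reach (nR {b} {0} (row<m ≤-refl) (col1<n k0))
          (nD {b} {0} mid<m (col0<n k0))
          (nLt {suc (dbl (suc B))} {c2 s'} (row<m ≤-refl) last)
          (inj₁ ne-s) (inj₁ s-ne) (inj₁ ss-ne)
          (seedEven (suc B) 0 ≤-refl k0) (seedMid 0 k0) (seedOdd (suc B) s' ≤-refl ks')

  rowB-col2-last : Reach b (c2 s')
  rowB-col2-last =
    reach (nL {b} {c1 s'} (row<m ≤-refl) (col2<n ks'))
          (nU {suc (dbl (suc B))} {c2 s'} (row<m ≤-refl) (col2<n ks'))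
          (nRt {b} {c2 s'} mid<m last)
          (inj₁ s-ne) (inj₁ ne-s) (inj₁ ne-ss)
          (seedEven (suc B) s' ≤-refl ks') (seedOdd (suc B) s' ≤-refl ks') (seedMid 0 k0)

  penult-col0 : ∀ g → suc g < s → Reach mm (tri (suc g)) → Reach m2 (tri (suc g))
  penult-col0 g q h =
    reach (nU {mid} {tri (suc g)} penult<m (col0<n q))
          (nL {m2} {c2 g} penult<m (col0<n q))
          (nD {m2} {tri (suc g)} mm<m (col0<n q))
          (inj₁ ne-s) (inj₁ ne-ss) (inj₁ ne-s)
          (seedMid (suc g) q) (seedPenult g (<-trans (n<1+n _) q)) h

  penult-col1 : ∀ g → g < s → Reach m2 (tri g) → Reach m2 (c1 g)
  penult-col1 g q h =
    reach (nR {m2} {c1 g} penult<m (col2<n q))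
          (nD {m2} {c1 g} mm<m (col1<n q))
          (nL {m2} {tri g} penult<m (col1<n q))
          (inj₁ ne-s) (inj₂ ss-ne) (inj₁ s-ne)
          (seedPenult g q) (seedLast g q) h

  mid-col1 : ∀ g → g < s → Reach m2 (c1 g) → Reach mid (c1 g)
  mid-col1 g q h =
    reach (nL {mid} {tri g} mid<m (col1<n q))
          (nU {b} {c1 g} mid<m (col1<n q))
          (nD {mid} {c1 g} penult<m (col1<n q))
          (inj₁ s-ne) (inj₁ ne-s) (inj₁ ne-ss)
          (seedMid g q) (seedEven (suc B) g ≤-refl q) h

  mid-col2 : ∀ g → suc g < s → Reach mid (c1 g) → Reach mid (c2 g)
  mid-col2 g q h =
    reach (nR {mid} {c2 g} mid<m (col0<n q))
          (nD {mid} {c2 g} penult<m (col2<n (<-trans (n<1+n _) q)))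
          (nL {mid} {c1 g} mid<m (col2<n (<-trans (n<1+n _) q)))
          (inj₁ ne-s) (inj₂ ss-ne) (inj₁ s-ne)
          (seedMid (suc g) q) (seedPenult g (<-trans (n<1+n _) q)) h

  mid-col2-last : Reach mid (c1 s') → Reach mid (c2 s')
  mid-col2-last h =
    reach (nU {b} {c2 s'} mid<m (col2<n ks'))
          (nD {mid} {c2 s'} penult<m (col2<n ks'))
          (nL {mid} {c1 s'} mid<m (col2<n ks'))
          (inj₁ ne-ss) (inj₁ ne-s) (inj₁ s-ne)
          rowB-col2-last (seedPenult s' ks') h

  rowB-col2 : ∀ g → g < s → Reach mid (c2 g) → Reach b (c2 g)
  rowB-col2 g q h =
    reach (nL {b} {c1 g} (row<m ≤-refl) (col2<n q))
          (nU {suc (dbl (suc B))} {c2 g} (row<m ≤-refl) (col2<n q))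
          (nD {b} {c2 g} mid<m (col2<n q))
          (inj₁ s-ne) (inj₁ ne-s) (inj₁ ne-ss)
          (seedEven (suc B) g ≤-refl q) (seedOdd (suc B) g ≤-refl q) h

  rowB-next : ∀ g → suc g < s → Reach b (c2 g) → Reach b (tri (suc g))
  rowB-next g q h =
    reach (nR {b} {tri (suc g)} (row<m ≤-refl) (col1<n q))
          (nD {b} {tri (suc g)} mid<m (col0<n q))
          (nL {b} {c2 g} (row<m ≤-refl) (col0<n q))
          (inj₁ ne-s) (inj₂ ss-ne) (inj₁ s-ne)
          (seedEven (suc B) (suc g) ≤-refl q) (seedMid (suc g) q) h

  penult-col0-twist : Reach mid (c2 s') → Reach m2 0
  penult-col0-twist h =
    reach (nU {mid} {0} penult<m (col0<n k0))
          (nD {m2} {0} mm<m (col0<n k0))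
          (nLt {mid} {c2 s'} penult<m last)
          (inj₁ ne-ss) (inj₂ (λ ())) (inj₁ ss-ne)
          (seedMid 0 k0) lastRow-col0 h

  penult-col0-from-col1 : Reach m2 1 → Reach m2 0
  penult-col0-from-col1 h =
    reach (nU {mid} {0} penult<m (col0<n k0))
          (nD {m2} {0} mm<m (col0<n k0))
          (nR {m2} {0} penult<m (col1<n k0))
          (inj₁ ne-ss) (inj₁ ne-s) (inj₁ s-ne)
          (seedMid 0 k0) lastRow-col0 h

  ChainA ChainB : ℕ → Set
  ChainA g = Reach b (tri g)
  ChainB g = Reach m2 (c1 g)

  reach10 : Reach 1 0
  reach10 = column0-top 0 k0 rowB-col0

  top-of : ∀ g → g < s → ChainA g → TopCells g
  top-of g q a = top-cells g q (column0-top g q a) reach10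

  chainA⇒B : ∀ g → suc g < s → ChainA g → ChainB (suc g)
  chainA⇒B g q a =
    penult-col1 (suc g) q (penult-col0 g q (lastRow-next g q
      (TopCells.last-col2 (top-of g (<-trans (n<1+n _) q) a))))

  chainB⇒A : ∀ g → suc g < s → ChainB g → ChainA (suc g)
  chainB⇒A g q h = rowB-next g q (rowB-col2 g g<s (mid-col2 g q (mid-col1 g g<s h)))
    where g<s = <-trans (n<1+n _) q

  chain : ChainB 0 → ∀ g → g < s → ChainA g × ChainB g
  chain h₀ zero    q = rowB-col0 , h₀
  chain h₀ (suc g) q with chain h₀ g (<-trans (n<1+n _) q)
  ... | a , b′ = chainB⇒A g q b′ , chainA⇒B g q a

  chain-alternating : ∀ t → (dbl t < s → ChainA (dbl t)) × (suc (dbl t) < s → ChainB (suc (dbl t)))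
  chain-alternating zero    = (λ _ → rowB-col0) , (λ q → chainA⇒B 0 q rowB-col0)
  chain-alternating (suc t) = A-next , B-next
    where
    A-next : suc (suc (dbl t)) < s → ChainA (suc (suc (dbl t)))
    A-next q = chainB⇒A (suc (dbl t)) q (proj₂ (chain-alternating t) (<-trans (n<1+n _) q))
    B-next : suc (suc (suc (dbl t))) < s → ChainB (suc (suc (suc (dbl t))))
    B-next q = chainA⇒B (suc (suc (dbl t))) q (A-next (<-trans (n<1+n _) q))

  -- for s = 2S'+2 the chain reaches B at block s−1, then (m−2, 1) via the seam
  chainB0-s-even : ∀ S' → suc (dbl S') ≡ s' → ChainB 0
  chainB0-s-even S' e =
    penult-col1 0 k0 (penult-col0-twist (mid-col2-last (mid-col1 s' ks'
      (subst ChainB e (proj₂ (chain-alternating S') (subst (_< s) (sym e) ks'))))))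

  cover : ChainB 0 → ∀ i j → i < m → j < n → Reach i j
  cover h₀ i j im jn with i ≤? b
  ... | yes i≤b = cover-upper (λ g q → proj₁ (chain h₀ g q)) reachB-col2 i j i≤b jn
    where
    reachB-col2 : ∀ g → g < s → Reach b (c2 g)
    reachB-col2 g q with suc g ≟ s
    ... | yes e = subst (λ z → Reach b (c2 z)) (sym (suc-injective e)) rowB-col2-last
    ... | no ne = rowB-col2 g q (mid-col2 g (≤∧≢⇒< q ne) (mid-col1 g q (proj₂ (chain h₀ g q))))
  ... | no i≰b = lower-rows i (≰⇒> i≰b) (subst (i <_) (sym m≡) im)
    where
    reachB-col0 : ∀ g → g < s → ChainA g
    reachB-col0 g q = proj₁ (chain h₀ g q)
    lastRow-col0s : ∀ g → g < s → Reach mm (tri g)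
    lastRow-col0s zero    q = lastRow-col0
    lastRow-col0s (suc g) q =
      lastRow-next g q (TopCells.last-col2 (top-of g (<-trans (n<1+n _) q) (reachB-col0 g (<-trans (n<1+n _) q))))
    midRow : Reach mid j
    midRow with column-block j jn
    ... | col≡0 g q = seedMid g q
    ... | col≡1 g q = mid-col1 g q (proj₂ (chain h₀ g q))
    ... | col≡2 g q with suc g ≟ s
    ...   | yes e = subst (λ z → Reach mid (c2 z)) (sym (suc-injective e))
                      (mid-col2-last (mid-col1 s' ks' (subst ChainB (suc-injective e) (proj₂ (chain h₀ g q)))))
    ...   | no ne = mid-col2 g (≤∧≢⇒< q ne) (mid-col1 g q (proj₂ (chain h₀ g q)))
    penultRow : Reach m2 j
    penultRow with column-block j jn
    ... | col≡0 zero q    = penult-col0-from-col1 (proj₂ (chain h₀ 0 q))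
    ... | col≡0 (suc g) q = penult-col0 g q (lastRow-col0s (suc g) q)
    ... | col≡1 g q       = proj₂ (chain h₀ g q)
    ... | col≡2 g q       = seedPenult g q
    lower-rows : ∀ i → b < i → i < suc (suc (suc (suc b))) → Reach i j
    lower-rows i b<i i<m with m≤n⇒m<n∨m≡n b<i
    ... | inj₂ refl = midRow
    ... | inj₁ p with m≤n⇒m<n∨m≡n p
    ... | inj₂ refl = penultRow
    ... | inj₁ p′ with m≤n⇒m<n∨m≡n p′
    ... | inj₂ refl = cover-last reachB-col0 lastRow-col0s j jn
    ... | inj₁ p″ = ⊥-elim (<-irrefl refl (≤-trans p″ (≤-pred i<m)))

-- The seeds

-- j mod 3, by recursion so that it unfolds along the blocks of three columns
mod3 : ℕ → ℕ
mod3 zero                = 0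
mod3 (suc zero)          = 1
mod3 (suc (suc zero))    = 2
mod3 (suc (suc (suc j))) = mod3 j

mod3-0 : ∀ k → mod3 (tri k) ≡ 0
mod3-0 zero    = refl
mod3-0 (suc k) = mod3-0 k

mod3-1 : ∀ k → mod3 (c1 k) ≡ 1
mod3-1 zero    = refl
mod3-1 (suc k) = mod3-1 k

mod3-2 : ∀ k → mod3 (c2 k) ≡ 2
mod3-2 zero    = refl
mod3-2 (suc k) = mod3-2 k

tri≡ : ∀ k → tri k ≡ 3 * k
tri≡ zero    = refl
tri≡ (suc k) = trans (cong (λ z → suc (suc (suc z))) (tri≡ k)) (sym (*-suc 3 k))

seedFrom : (ℕ → ℕ) → (ℕ → Bool) → ℕ → ℕ → Bool
seedFrom p x i j = (mod3 j ≡ᵇ p i) ∨ (x i ∧ (j ≡ᵇ 1))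

module Seeded (m n : ℕ) (p : ℕ → ℕ) (x : ℕ → Bool) where

  seed : VSet m n
  seed v = seedFrom p x (toℕ (proj₁ v)) (toℕ (proj₂ v))

  open Process seed public

  reached-seed : ∀ i j → seedFrom p x i j ≡ true → Reached i j
  reached-seed i j h v refl refl = 0 , h

  reached-pattern : ∀ i j → mod3 j ≡ p i → Reached i j
  reached-pattern i j e = reached-seed i j (∨-introˡ _ (subst (λ z → (z ≡ᵇ p i) ≡ true) (sym e) (≡ᵇ-refl (p i))))

  reached-extra : ∀ i → x i ≡ true → Reached i 1
  reached-extra i h = reached-seed i 1 (∨-introʳ (mod3 1 ≡ᵇ p i) (∧-intro₂ h refl))

-- rows 0, 1, 2, 3, 4, … get residues 0, 2, 1, 2, 1, …
alternating : ℕ → ℕ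
alternating zero          = 2
alternating (suc zero)    = 1
alternating (suc (suc i)) = alternating i

basePattern : ℕ → ℕ
basePattern zero    = 0
basePattern (suc i) = alternating i

basePattern-odd : ∀ t → basePattern (suc (dbl t)) ≡ 2
basePattern-odd zero    = refl
basePattern-odd (suc t) = basePattern-odd t

basePattern-even : ∀ t → basePattern (suc (suc (dbl t))) ≡ 1
basePattern-even zero    = refl
basePattern-even (suc t) = basePattern-even t

oddExtra : ℕ → Bool
oddExtra i = i ≡ᵇ 0

oddSeed-percolates : ∀ B s' →
  Percolates 3 (Seeded.seed (suc (suc (suc (suc (suc (dbl B)))))) (3 * suc s') basePattern oddExtra)
oddSeed-percolates B s' = percolates-if-reached OS.cover
  where
  m = suc (suc (suc (suc (suc (dbl B)))))
  n = 3 * suc s'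
  open Seeded m n basePattern oddExtra
  module OS = OddSchedule m n s' B refl (tri≡ (suc s')) Reached reach-by-three
     (λ k _ → reached-pattern 0 (tri k) (mod3-0 k))
     (reached-extra 0 refl)
     (λ t k _ _ → reached-pattern (suc (dbl t)) (c2 k) (trans (mod3-2 k) (sym (basePattern-odd t))))
     (λ t k _ _ → reached-pattern (suc (suc (dbl t))) (c1 k) (trans (mod3-1 k) (sym (basePattern-even t))))
     (λ k _ → reached-pattern (suc (suc (dbl (suc B)))) (c1 k) (trans (mod3-1 k) (sym (basePattern-even (suc B)))))
     (λ k _ → reached-pattern (suc (dbl (suc B))) (c2 k) (trans (mod3-2 k) (sym (basePattern-odd (suc B)))))

-- m = 2B+8 even: the base pattern on rows 0 … b = 2B+4, then residues 0, 2, 1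
-- on rows b+1, b+2, b+3; extra vertices (0 , 1), and (b+2 , 1) when f holds
bEven : ℕ → ℕ
bEven B = suc (suc (suc (suc (dbl B))))

evenPattern : ℕ → ℕ → ℕ
evenPattern B i =
  if i ≤ᵇ bEven B then basePattern i
  else (if i ≡ᵇ suc (suc (bEven B)) then 2 else (if i ≡ᵇ suc (suc (suc (bEven B))) then 1 else 0))

evenExtra : ℕ → Bool → ℕ → Bool
evenExtra B f i = (i ≡ᵇ 0) ∨ (f ∧ (i ≡ᵇ suc (suc (bEven B))))

evenPattern-upper : ∀ B i → i ≤ bEven B → evenPattern B i ≡ basePattern i
evenPattern-upper B i p rewrite ≤ᵇ-complete {i} {bEven B} p = refl

evenPattern-mid : ∀ B → evenPattern B (suc (bEven B)) ≡ 0
evenPattern-mid B rewrite ≤ᵇ-false (suc (bEven B)) (bEven B) ≤-refl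
                        | ≡ᵇ-false (suc (bEven B)) (suc (suc (bEven B))) ne-s
                        | ≡ᵇ-false (suc (bEven B)) (suc (suc (suc (bEven B)))) ne-ss = refl

evenPattern-penult : ∀ B → evenPattern B (suc (suc (bEven B))) ≡ 2
evenPattern-penult B rewrite ≤ᵇ-false (suc (suc (bEven B))) (bEven B) (<-trans (n<1+n _) (n<1+n _))
                           | ≡ᵇ-refl (suc (suc (bEven B))) = refl

evenPattern-last : ∀ B → evenPattern B (suc (suc (suc (bEven B)))) ≡ 1
evenPattern-last B
  rewrite ≤ᵇ-false (suc (suc (suc (bEven B)))) (bEven B) (<-trans (<-trans (n<1+n _) (n<1+n _)) (n<1+n _))
        | ≡ᵇ-false (suc (suc (suc (bEven B)))) (suc (suc (bEven B))) s-ne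
        | ≡ᵇ-refl (suc (suc (suc (bEven B)))) = refl

module EvenSeeded (B s' : ℕ) (f : Bool) where
  m = suc (suc (suc (suc (suc (suc (suc (suc (dbl B))))))))
  n = 3 * suc s'
  open Seeded m n (evenPattern B) (evenExtra B f) public
  module ES = EvenSchedule m n s' B refl (tri≡ (suc s')) Reached reach-by-three
     (λ k _ → reached-pattern 0 (tri k) (mod3-0 k))
     (reached-extra 0 refl)
     (λ t k p _ → reached-pattern (suc (dbl t)) (c2 k)
                    (trans (mod3-2 k) (sym (trans (evenPattern-upper B _ (<⇒≤ p)) (basePattern-odd t)))))
     (λ t k p _ → reached-pattern (suc (suc (dbl t))) (c1 k)
                    (trans (mod3-1 k) (sym (trans (evenPattern-upper B _ p) (basePattern-even t)))))
     (λ k _ → reached-pattern (suc (suc (suc (bEven B)))) (c1 k) (trans (mod3-1 k) (sym (evenPattern-last B))))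
     (λ k _ → reached-pattern (suc (suc (bEven B))) (c2 k) (trans (mod3-2 k) (sym (evenPattern-penult B))))
     (λ k _ → reached-pattern (suc (bEven B)) (tri k) (trans (mod3-0 k) (sym (evenPattern-mid B))))

evenSeed-percolates-s-even : ∀ B S' →
  Percolates 3 (Seeded.seed (suc (suc (suc (suc (suc (suc (suc (suc (dbl B)))))))))
                            (3 * suc (suc (dbl S'))) (evenPattern B) (evenExtra B false))
evenSeed-percolates-s-even B S' = percolates-if-reached (ES.cover (ES.chainB0-s-even S' refl))
  where open EvenSeeded B (suc (dbl S')) false

-- any s: the extra vertex (b+2 , 1) starts the chain directly
evenSeed-percolates : ∀ B s' →
  Percolates 3 (Seeded.seed (suc (suc (suc (suc (suc (suc (suc (suc (dbl B)))))))))
                            (3 * suc s') (evenPattern B) (evenExtra B true))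
evenSeed-percolates B s' = percolates-if-reached (ES.cover (reached-extra (suc (suc (bEven B))) second-extra))
  where
  open EvenSeeded B s' true
  second-extra : evenExtra B true (suc (suc (bEven B))) ≡ true
  second-extra = ∨-introʳ _ (≡ᵇ-refl (suc (suc (bEven B))))

sumN : ℕ → (ℕ → ℕ) → ℕ
sumN zero    g = 0
sumN (suc n) g = g 0 + sumN n (λ j → g (suc j))

sumFin-toℕ : ∀ n (g : ℕ → ℕ) → sumFin {n} (λ j → g (toℕ j)) ≡ sumN n g
sumFin-toℕ zero    g = refl
sumFin-toℕ (suc n) g = cong (g 0 +_) (sumFin-toℕ n (λ j → g (suc j)))

sumN-cong : ∀ n {f g : ℕ → ℕ} → (∀ j → f j ≡ g j) → sumN n f ≡ sumN n g
sumN-cong zero    e = refl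
sumN-cong (suc n) e = cong₂ _+_ (e 0) (sumN-cong n (λ j → e (suc j)))

sumN-+ : ∀ n (f g : ℕ → ℕ) → sumN n (λ j → f j + g j) ≡ sumN n f + sumN n g
sumN-+ n f g = begin
  sumN n (λ j → f j + g j)                     ≡⟨ sym (sumFin-toℕ n (λ j → f j + g j)) ⟩
  sumFin {n} (λ j → f (toℕ j) + g (toℕ j))     ≡⟨ sum-+ {n} (λ j → f (toℕ j)) (λ j → g (toℕ j)) ⟩
  sumFin {n} (λ j → f (toℕ j)) + sumFin {n} (λ j → g (toℕ j))
                                               ≡⟨ cong₂ _+_ (sumFin-toℕ n f) (sumFin-toℕ n g) ⟩
  sumN n f + sumN n g                          ∎
  where open ≡-Reasoning

sumN-zero : ∀ n → sumN n (λ _ → 0) ≡ 0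
sumN-zero zero    = refl
sumN-zero (suc n) = sumN-zero n

sumN-const : ∀ n c → sumN n (λ _ → c) ≡ n * c
sumN-const zero    c = refl
sumN-const (suc n) c = cong (c +_) (sumN-const n c)

sumN-point : ∀ n a → a < n → sumN n (λ j → ⟦ j ≡ᵇ a ⟧) ≡ 1
sumN-point (suc n) zero    _       = cong suc (trans (sumN-cong n (λ _ → refl)) (sumN-zero n))
sumN-point (suc n) (suc a) (s≤s p) = sumN-point n a p

count-residue : ∀ s c → c ≤ 2 → sumN (tri s) (λ j → ⟦ mod3 j ≡ᵇ c ⟧) ≡ s
count-residue zero    c _ = refl
count-residue (suc s) zero _ = cong suc (count-residue s 0 z≤n)
count-residue (suc s) (suc zero) _ = cong suc (count-residue s 1 (s≤s z≤n))
count-residue (suc s) (suc (suc zero)) _ = cong suc (count-residue s 2 (s≤s (s≤s z≤n)))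
count-residue (suc s) (suc (suc (suc c))) (s≤s (s≤s ()))

count-extra : ∀ n x → 2 ≤ n → sumN n (λ j → ⟦ x ∧ (j ≡ᵇ 1) ⟧) ≡ ⟦ x ⟧
count-extra n false _ = trans (sumN-cong n (λ _ → refl)) (sumN-zero n)
count-extra n true  p = sumN-point n 1 p

pattern-extra-disjoint : ∀ c x → (x ≡ true → (1 ≡ᵇ c) ≡ false) →
  ∀ j → (mod3 j ≡ᵇ c) ≡ true → x ∧ (j ≡ᵇ 1) ≡ false
pattern-extra-disjoint c false hx j e = refl
pattern-extra-disjoint c true hx zero e = refl
pattern-extra-disjoint c true hx (suc zero) e with trans (sym (hx refl)) e
... | ()
pattern-extra-disjoint c true hx (suc (suc j)) e = refl

row-size : ∀ s c x → c ≤ 2 → (x ≡ true → (1 ≡ᵇ c) ≡ false) →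
  sumN (tri (suc s)) (λ j → ⟦ seedFrom (λ _ → c) (λ _ → x) 0 j ⟧) ≡ suc s + ⟦ x ⟧
row-size s c x c≤2 hx = begin
  sumN (tri (suc s)) (λ j → ⟦ (mod3 j ≡ᵇ c) ∨ (x ∧ (j ≡ᵇ 1)) ⟧)
    ≡⟨ sumN-cong (tri (suc s)) (λ j → ⟦∨⟧-disjoint (mod3 j ≡ᵇ c) (x ∧ (j ≡ᵇ 1)) (pattern-extra-disjoint c x hx j)) ⟩
  sumN (tri (suc s)) (λ j → ⟦ mod3 j ≡ᵇ c ⟧ + ⟦ x ∧ (j ≡ᵇ 1) ⟧)
    ≡⟨ sumN-+ (tri (suc s)) (λ j → ⟦ mod3 j ≡ᵇ c ⟧) (λ j → ⟦ x ∧ (j ≡ᵇ 1) ⟧) ⟩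
  sumN (tri (suc s)) (λ j → ⟦ mod3 j ≡ᵇ c ⟧) + sumN (tri (suc s)) (λ j → ⟦ x ∧ (j ≡ᵇ 1) ⟧)
    ≡⟨ cong₂ _+_ (count-residue (suc s) c c≤2) (count-extra (tri (suc s)) x (s≤s (s≤s z≤n))) ⟩
  suc s + ⟦ x ⟧ ∎
  where open ≡-Reasoning

size-seedFrom : ∀ m s (p : ℕ → ℕ) (x : ℕ → Bool) → (∀ i → p i ≤ 2) →
  (∀ i → x i ≡ true → (1 ≡ᵇ p i) ≡ false) →
  size (Seeded.seed m (3 * suc s) p x) ≡ m * suc s + sumN m (λ i → ⟦ x i ⟧)
size-seedFrom m s p x p≤2 hx = begin
  size (Seeded.seed m (3 * suc s) p x)
    ≡⟨ sum-cong {m} (λ i → sumFin-toℕ (3 * suc s) (λ j → ⟦ seedFrom p x (toℕ i) j ⟧)) ⟩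
  sumFin {m} (λ i → sumN (3 * suc s) (λ j → ⟦ seedFrom p x (toℕ i) j ⟧))
    ≡⟨ sumFin-toℕ m (λ i → sumN (3 * suc s) (λ j → ⟦ seedFrom p x i j ⟧)) ⟩
  sumN m (λ i → sumN (3 * suc s) (λ j → ⟦ seedFrom p x i j ⟧))
    ≡⟨ sumN-cong m (λ i → trans (cong (λ z → sumN z (λ j → ⟦ seedFrom p x i j ⟧)) (sym (tri≡ (suc s))))
                               (row-size s (p i) (x i) (p≤2 i) (hx i))) ⟩
  sumN m (λ i → suc s + ⟦ x i ⟧)
    ≡⟨ sumN-+ m (λ _ → suc s) (λ i → ⟦ x i ⟧) ⟩
  sumN m (λ _ → suc s) + sumN m (λ i → ⟦ x i ⟧)
    ≡⟨ cong (_+ sumN m (λ i → ⟦ x i ⟧)) (sumN-const m (suc s)) ⟩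
  m * suc s + sumN m (λ i → ⟦ x i ⟧) ∎
  where open ≡-Reasoning

alternating≤2 : ∀ i → alternating i ≤ 2
alternating≤2 zero          = ≤-refl
alternating≤2 (suc zero)    = s≤s z≤n
alternating≤2 (suc (suc i)) = alternating≤2 i

basePattern≤2 : ∀ i → basePattern i ≤ 2
basePattern≤2 zero    = z≤n
basePattern≤2 (suc i) = alternating≤2 i

size-oddSeed : ∀ B s' →
  size (Seeded.seed (suc (suc (suc (suc (suc (dbl B)))))) (3 * suc s') basePattern oddExtra)
    ≡ suc (suc (suc (suc (suc (dbl B))))) * suc s' + 1
size-oddSeed B s' =
  trans (size-seedFrom m s' basePattern oddExtra basePattern≤2 row0-only)
        (cong (m * suc s' +_) (sumN-point m 0 (s≤s z≤n)))
  where
  m = suc (suc (suc (suc (suc (dbl B)))))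
  row0-only : ∀ i → oddExtra i ≡ true → (1 ≡ᵇ basePattern i) ≡ false
  row0-only zero _ = refl

evenPattern≤2 : ∀ B i → evenPattern B i ≤ 2
evenPattern≤2 B i with i ≤ᵇ bEven B
... | true = basePattern≤2 i
... | false with i ≡ᵇ suc (suc (bEven B))
... | true = ≤-refl
... | false with i ≡ᵇ suc (suc (suc (bEven B)))
... | true  = s≤s z≤n
... | false = z≤n

size-evenSeed : ∀ B s' f →
  size (Seeded.seed (suc (suc (suc (suc (suc (suc (suc (suc (dbl B)))))))))
                    (3 * suc s') (evenPattern B) (evenExtra B f))
    ≡ suc (suc (suc (suc (suc (suc (suc (suc (dbl B)))))))) * suc s' + (1 + ⟦ f ⟧)
size-evenSeed B s' f =
  trans (size-seedFrom m s' (evenPattern B) (evenExtra B f) (evenPattern≤2 B) extra-rows)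
        (cong (m * suc s' +_) extra-count)
  where
  m = suc (suc (suc (suc (suc (suc (suc (suc (dbl B))))))))
  r = suc (suc (bEven B))
  extra-rows : ∀ i → evenExtra B f i ≡ true → (1 ≡ᵇ evenPattern B i) ≡ false
  extra-rows zero _ = refl
  extra-rows (suc i) h with ∧-elim₂ f (suc i ≡ᵇ r) h
  ... | _ , e = trans (cong (λ z → 1 ≡ᵇ evenPattern B z) (≡ᵇ-sound (suc i) r e)) (cong (1 ≡ᵇ_) (evenPattern-penult B))
  row-r : ∀ f → sumN m (λ i → ⟦ f ∧ (i ≡ᵇ r) ⟧) ≡ ⟦ f ⟧
  row-r false = trans (sumN-cong m {λ i → ⟦ false ∧ (i ≡ᵇ r) ⟧} {λ _ → 0} (λ _ → refl)) (sumN-zero m)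
  row-r true  = sumN-point m r (<-trans (n<1+n r) (n<1+n _))
  row0-not-r : ∀ i → (i ≡ᵇ 0) ≡ true → f ∧ (i ≡ᵇ r) ≡ false
  row0-not-r zero _ = ∧-zeroʳ f
  extra-count : sumN m (λ i → ⟦ evenExtra B f i ⟧) ≡ 1 + ⟦ f ⟧
  extra-count = begin
    sumN m (λ i → ⟦ evenExtra B f i ⟧)
      ≡⟨ sumN-cong m (λ i → ⟦∨⟧-disjoint (i ≡ᵇ 0) (f ∧ (i ≡ᵇ r)) (row0-not-r i)) ⟩
    sumN m (λ i → ⟦ i ≡ᵇ 0 ⟧ + ⟦ f ∧ (i ≡ᵇ r) ⟧)
      ≡⟨ sumN-+ m (λ i → ⟦ i ≡ᵇ 0 ⟧) (λ i → ⟦ f ∧ (i ≡ᵇ r) ⟧) ⟩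
    sumN m (λ i → ⟦ i ≡ᵇ 0 ⟧) + sumN m (λ i → ⟦ f ∧ (i ≡ᵇ r) ⟧)
      ≡⟨ cong₂ _+_ (sumN-point m 0 (s≤s z≤n)) (row-r f) ⟩
    1 + ⟦ f ⟧ ∎
    where open ≡-Reasoning

-- Deciding whether a seed of a given size percolates

step-cong : ∀ {m n} θ {X Y : VSet m n} → X ≗ Y → step θ X ≗ step θ Y
step-cong θ e v = cong₂ _∨_ (e v) (cong (θ ≤ᵇ_) (ΣV-cong (λ w → cong (λ z → ⟦ adj v w ∧ z ⟧) (e w))))

activeAt-cong : ∀ {m n} θ {S S' : VSet m n} → S ≗ S' → ∀ t → activeAt θ S t ≗ activeAt θ S' t
activeAt-cong θ e zero    = e
activeAt-cong θ e (suc t) = step-cong θ (activeAt-cong θ e t)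

size-cong : ∀ {m n} {S S' : VSet m n} → S ≗ S' → size S ≡ size S'
size-cong e = ΣV-cong (λ v → cong ⟦_⟧ (e v))

size-strict : ∀ {m n} (X Y : VSet m n) → (∀ v → X v ≡ true → Y v ≡ true) →
  ∀ v₀ → X v₀ ≡ false → Y v₀ ≡ true → suc (size X) ≤ size Y
size-strict X Y X⊆Y v₀ x₀ y₀ = begin
  suc (size X)               ≡⟨ +-comm 1 (size X) ⟩
  size X + 1                 ≤⟨ +-monoʳ-≤ (size X) (δ-count v₀) ⟩
  size X + ΣV (δ v₀)         ≡⟨ sym (ΣV-+ (λ v → ⟦ X v ⟧) (δ v₀)) ⟩
  ΣV (λ v → ⟦ X v ⟧ + δ v₀ v) ≤⟨ ΣV-mono pointwise ⟩
  size Y                     ∎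
  where
  open ≤-Reasoning
  pointwise : ∀ v → ⟦ X v ⟧ + δ v₀ v ≤ ⟦ Y v ⟧
  pointwise v with v ≟V v₀
  ... | yes refl rewrite x₀ | y₀ = ≤-refl
  ... | no _ with X v in ex
  ... | true rewrite X⊆Y v ex = ≤-refl
  ... | false = z≤n

size≤ : ∀ {m n} (X : VSet m n) → size X ≤ m * (n * 1)
size≤ {m} {n} X = ≤-trans (ΣV-mono (λ v → ⟦⟧≤1 (X v))) (≤-reflexive (ΣV-const m n 1))

-- the process stabilises within N = m·n steps, since each non-final step
-- adds a vertex; so S percolates iff everything is active at time N
module Stabilisation {m n : ℕ} (θ : ℕ) (S : VSet m n) where

  A : ℕ → VSet m n
  A t = activeAt θ S t

  N = m * (n * 1)

  stable-forever : ∀ t₀ → A (suc t₀) ≗ A t₀ → ∀ d → A (d + t₀) ≗ A t₀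
  stable-forever t₀ fixed zero    v = refl
  stable-forever t₀ fixed (suc d) v = trans (step-cong θ (stable-forever t₀ fixed d) v) (fixed v)

  A-mono : ∀ {t t'} v → t ≤ t' → A t v ≡ true → A t' v ≡ true
  A-mono {t} {t'} v t≤t' h = subst (λ z → A z v ≡ true) (m∸n+n≡m t≤t') (later (t' ∸ t) h)
    where
    later : ∀ d → A t v ≡ true → A (d + t) v ≡ true
    later zero    h = h
    later (suc d) h = ∨-introˡ _ (later d h)

  private
    -- with a = A t v and a ∨ x = A (t+1) v
    unchanged : ∀ a x → not (a ∨ x) ∨ a ≡ true → a ∨ x ≡ a
    unchanged true  x _ = refl
    unchanged false false _ = refl

    changed : ∀ a x → not (a ∨ x) ∨ a ≡ false → a ≡ false × a ∨ x ≡ true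
    changed false true _ = refl , refl

  grows-or-stabilises : ∀ t → (∃ λ t₀ → t₀ < t × A (suc t₀) ≗ A t₀) ⊎ t ≤ size (A t)
  grows-or-stabilises zero = inj₂ z≤n
  grows-or-stabilises (suc t) with grows-or-stabilises t
  ... | inj₁ (t₀ , t₀<t , fixed) = inj₁ (t₀ , <-trans t₀<t (n<1+n t) , fixed)
  ... | inj₂ t≤size with full? (λ v → not (A (suc t) v) ∨ A t v)
  ... | yes same = inj₁ (t , n<1+n t , λ v → unchanged (A t v) _ (same v))
  ... | no differs with not-full _ differs
  ... | v , new with changed (A t v) _ new
  ... | old , now =
    inj₂ (≤-trans (s≤s t≤size) (size-strict (A t) (A (suc t)) (λ v h → ∨-introˡ _ h) v old now))

  stable-by-N : ∃ λ t₀ → t₀ ≤ N × A (suc t₀) ≗ A t₀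
  stable-by-N with grows-or-stabilises (suc N)
  ... | inj₁ (t₀ , t₀<N+1 , fixed) = t₀ , ≤-pred t₀<N+1 , fixed
  ... | inj₂ N+1≤size = ⊥-elim (1+n≰n (≤-trans N+1≤size (size≤ (A (suc N)))))

  percolates-by-N : Percolates θ S → ∀ v → A N v ≡ true
  percolates-by-N (t , full) v with t ≤? N
  ... | yes t≤N = A-mono v t≤N (full v)
  ... | no t≰N with stable-by-N
  ... | t₀ , t₀≤N , fixed =
    A-mono v t₀≤N (trans (sym (subst (λ z → A z v ≡ A t₀ v) (m∸n+n≡m t₀≤t) (stable-forever t₀ fixed (t ∸ t₀) v))) (full v))
    where
    t₀≤t : t₀ ≤ t
    t₀≤t = ≤-trans t₀≤N (<⇒≤ (≰⇒> t≰N))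

-- exhaustive search over all vertex sets, via subsets of Fin (m·n)
search : ∀ m n (P : VSet m n → Set) → (∀ {S S'} → S ≗ S' → P S → P S') →
  (∀ S → Dec (P S)) → Dec (∃ P)
search m n P resp dec with anySubset? (λ s → dec (decode s))
  where
  decode : Subset (m * n) → VSet m n
  decode s (i , j) = lookup s (combine i j)
... | yes (s , p) = yes (_ , p)
... | no none = no λ (S , pS) → none (encode S , resp (λ v → sym (decode-encode S v)) pS)
  where
  encode : VSet m n → Subset (m * n)
  encode S = tabulate (λ x → S (remQuot n x))
  decode-encode : ∀ S v → lookup (encode S) (combine (proj₁ v) (proj₂ v)) ≡ S v
  decode-encode S (i , j) = trans (lookup∘tabulate _ (combine i j)) (cong S (remQuot-combine i j))

-- a lower bound k, met or missed by one by a percolating seed, pins down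
-- min-seed: whether a seed of size k percolates is decidable
min-seed-between : ∀ {m n} θ k → (∀ S → Percolates θ S → k ≤ size S) →
  (S₁ : VSet m n) → Percolates θ S₁ → size S₁ ≡ suc k →
  ∃ λ c → IsMinSeed m n θ c × (c ≡ k ⊎ c ≡ suc k)
min-seed-between {m} {n} θ k lower S₁ perc₁ size₁ with search m n SmallSeed respects decide
  where
  N = m * (n * 1)
  SmallSeed : VSet m n → Set
  SmallSeed S = size S ≡ k × (∀ v → activeAt θ S N v ≡ true)
  respects : ∀ {S S'} → S ≗ S' → SmallSeed S → SmallSeed S'
  respects e (size≡ , full) =
    trans (sym (size-cong e)) size≡ , (λ v → trans (sym (activeAt-cong θ e N v)) (full v))
  decide : ∀ S → Dec (SmallSeed S)
  decide S = (size S ≟ k) ×-dec full? (activeAt θ S N)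
... | yes (S , size≡ , full) = k , ((S , (m * (n * 1) , full) , size≡) , lower) , inj₁ refl
... | no none = suc k , ((S₁ , perc₁ , size₁) , lower′) , inj₂ refl
  where
  lower′ : ∀ S → Percolates θ S → suc k ≤ size S
  lower′ S p = ≤∧≢⇒< (lower S p) (λ e → none (S , sym e , Stabilisation.percolates-by-N θ S p))

min-seed-odd : ∀ B s' →
  let m = suc (suc (suc (suc (suc (dbl B))))) in
  IsMinSeed m (3 * suc s') 3 (m * suc s' + 1)
min-seed-odd B s' =
  (Seeded.seed _ _ basePattern oddExtra , oddSeed-percolates B s' , size-oddSeed B s') ,
  seed-lower-bound _ (suc s') (s≤s z≤n)

min-seed-even-even : ∀ B S' →
  let m = suc (suc (suc (suc (suc (suc (suc (suc (dbl B)))))))) ; s = suc (suc (dbl S')) in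
  IsMinSeed m (3 * s) 3 (m * s + 1)
min-seed-even-even B S' =
  (Seeded.seed _ _ (evenPattern B) (evenExtra B false) , evenSeed-percolates-s-even B S' ,
   size-evenSeed B (suc (dbl S')) false) ,
  seed-lower-bound _ (suc (suc (dbl S'))) (s≤s z≤n)

min-seed-even : ∀ B s' →
  let m = suc (suc (suc (suc (suc (suc (suc (suc (dbl B)))))))) in
  ∃ λ c → IsMinSeed m (3 * suc s') 3 c × (c ≡ m * suc s' + 1 ⊎ c ≡ m * suc s' + 2)
min-seed-even B s' =
  restate (min-seed-between 3 (m * suc s' + 1) (seed-lower-bound m (suc s') (s≤s z≤n))
             (Seeded.seed _ _ (evenPattern B) (evenExtra B true)) (evenSeed-percolates B s')
             (trans (size-evenSeed B s' true) (+-suc (m * suc s') 1)))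
  where
  m = suc (suc (suc (suc (suc (suc (suc (suc (dbl B))))))))
  restate : ∀ {P : ℕ → Set} → (∃ λ c → P c × (c ≡ m * suc s' + 1 ⊎ c ≡ suc (m * suc s' + 1))) →
            ∃ λ c → P c × (c ≡ m * suc s' + 1 ⊎ c ≡ m * suc s' + 2)
  restate (c , min-seed , inj₁ c≡) = c , min-seed , inj₁ c≡
  restate (c , min-seed , inj₂ c≡) = c , min-seed , inj₂ (trans c≡ (sym (+-suc (m * suc s') 1)))

dbl≡ : ∀ k → dbl k ≡ 2 * k
dbl≡ zero    = refl
dbl≡ (suc k) = trans (cong (λ z → suc (suc z)) (dbl≡ k)) (sym (*-suc 2 k))

odd-shape : ∀ {m} → Odd m → 5 ≤ m → ∃ λ B → m ≡ suc (suc (suc (suc (suc (dbl B)))))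
odd-shape (zero , refl)       (s≤s ())
odd-shape (suc zero , refl)   (s≤s (s≤s (s≤s ())))
odd-shape (suc (suc B) , refl) _ =
  B , trans (+-comm (2 * suc (suc B)) 1) (cong suc (sym (dbl≡ (suc (suc B)))))

even-shape : ∀ {m} → Even m → 8 ≤ m → ∃ λ B → m ≡ suc (suc (suc (suc (suc (suc (suc (suc (dbl B))))))))
even-shape (zero , refl)                ()
even-shape (suc zero , refl)            (s≤s (s≤s ()))
even-shape (suc (suc zero) , refl)      (s≤s (s≤s (s≤s (s≤s ()))))
even-shape (suc (suc (suc zero)) , refl) (s≤s (s≤s (s≤s (s≤s (s≤s (s≤s ()))))))
even-shape (suc (suc (suc (suc B))) , refl) _ = B , sym (dbl≡ (suc (suc (suc (suc B)))))

even-positive-shape : ∀ s' → Even (suc s') → ∃ λ S' → suc s' ≡ suc (suc (dbl S'))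
even-positive-shape s' (zero , ())
even-positive-shape s' (suc S' , e) = S' , trans e (sym (dbl≡ (suc S')))

theorem3p2 : ∀ (s : ℕ) → 2 ≤ s →
    (∀ (m : ℕ) → 5 ≤ m → Odd m → IsMinSeed m (3 * s) 3 (m * s + 1))
    × (∀ (m : ℕ) → 8 ≤ m → Even m → Even s → IsMinSeed m (3 * s) 3 (m * s + 1))
    × (∀ (m : ℕ) → 8 ≤ m → Even m → Odd s →
    ∃ λ c → IsMinSeed m (3 * s) 3 c × (c ≡ m * s + 1 ⊎ c ≡ m * s + 2))
theorem3p2 (suc s') _ = part-a , part-b , part-c
  where
  part-a : ∀ m → 5 ≤ m → Odd m → IsMinSeed m (3 * suc s') 3 (m * suc s' + 1)
  part-a m 5≤m m-odd with odd-shape m-odd 5≤m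
  ... | B , refl = min-seed-odd B s'

  part-b : ∀ m → 8 ≤ m → Even m → Even (suc s') → IsMinSeed m (3 * suc s') 3 (m * suc s' + 1)
  part-b m 8≤m m-even s-even with even-shape m-even 8≤m | even-positive-shape s' s-even
  ... | B , refl | S' , s≡ = subst (λ z → IsMinSeed m (3 * z) 3 (m * z + 1)) (sym s≡) (min-seed-even-even B S')

  part-c : ∀ m → 8 ≤ m → Even m → Odd (suc s') →
    ∃ λ c → IsMinSeed m (3 * suc s') 3 c × (c ≡ m * suc s' + 1 ⊎ c ≡ m * suc s' + 2)
  part-c m 8≤m m-even _ with even-shape m-even 8≤m
  ... | B , refl = min-seed-even B s'
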